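{- Let $r,s$ be positive integers. If $1\le r\le 3$, then $M(2^r3^s)=11$ if $s=1$, $M(2^r3^s)=9$ if $s=2$, and $M(2^r3^s)=7$ if $s\ge3$. If $r\ge 4$, then $M(2^r3^s)=9$ if $s=1$, $M(2^r3^s)=7$ if $s=2$, and $M(2^r3^s)=5$ if $s\ge 3$. Let $p\ge 5$ be a prime and $r,s$ positive integers. Then $M(2^rp^s)=9$ if $s=1$ and either $p=2^r+1$ or $p=2^r-1$; $M(2^rp^s)=7$ if $s\ge 2$ and either $p=2^r+1$ or $p=2^r-1$; $M(2^rp^s)=7$ if $s=1$ and either $p$ is a Fermat prime with $p\ne 2^r+1$, or $p$ is a Mersenne prime with $p\neq 2^r-1$; and $M(2^rp^s)=5$ in all other cases.
   Context: A pair $(a,b)\in\mathbb{Z}^2$ is multiplicatively dependent if $ab\neq 0$ and there is $(k_1,k_2)\in\mathbb{Z}^2\setminus\{(0,0)\}$ with $a^{k_1}b^{k_2}=1$. For $d\in\mathbb{Z}$, $\mathcal{M}(d)$ is the set of multiplicatively dependent pairs $(a,b)\in\mathbb{Z}^2$ with $ab\ne0$ and $b-a=d$, and $M(d)=|\mathcal{M}(d)|$. A Fermat prime is a prime of the form $2^m+1$ with $m$ a positive integer; a Mersenne prime is a prime of the form $2^m-1$ with $m$ a positive integer. -}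

module Defs where

open import Data.Nat as ℕ using (ℕ; suc; _≤_)
open import Data.Nat.Primality using (Prime)
open import Data.Integer as ℤ using (ℤ; +_; -[1+_]; _*_; _-_; _^_)
open import Data.Product using (_×_; Σ; ∃; _,_)
open import Data.List using (List; length)
open import Data.List.Membership.Propositional using (_∈_)
open import Data.List.Relation.Unary.Unique.Propositional using (Unique)
open import Relation.Binary.PropositionalEquality using (_≡_)
open import Relation.Nullary using (¬_)
open import Function.Bundles using (_⇔_)

posPart : ℤ → ℕ
posPart (+ n) = n
posPart -[1+ n ] = 0

negPart : ℤ → ℕ
negPart (+ n) = 0
negPart -[1+ n ] = suc n

-- a^{k₁} b^{k₂} = 1 (in ℚ, with a b ≠ 0), written with denominators cleared:
-- a^{k₁⁺} b^{k₂⁺} = a^{k₁⁻} b^{k₂⁻}.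
PowProdIsOne : ℤ → ℤ → ℤ → ℤ → Set
PowProdIsOne a b k₁ k₂ =
  (a ^ posPart k₁) * (b ^ posPart k₂) ≡ (a ^ negPart k₁) * (b ^ negPart k₂)

MultDep : ℤ × ℤ → Set
MultDep (a , b) =
  ¬ (a * b ≡ + 0) ×
  Σ ℤ (λ k₁ → Σ ℤ (λ k₂ → ¬ ((k₁ ≡ + 0) × (k₂ ≡ + 0)) × PowProdIsOne a b k₁ k₂))

InM : ℤ → ℤ × ℤ → Set
InM d (a , b) = MultDep (a , b) × (b - a ≡ d)

HasCard : (ℤ × ℤ → Set) → ℕ → Set
HasCard P n = Σ (List (ℤ × ℤ)) λ xs →
  Unique xs × (length xs ≡ n) × (∀ x → (P x ⇔ (x ∈ xs)))

MEq : ℤ → ℕ → Set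
MEq d n = HasCard (InM d) n

FermatPrime : ℕ → Set
FermatPrime p = Prime p × Σ ℕ (λ m → (1 ≤ m) × (p ≡ 2 ℕ.^ m ℕ.+ 1))

MersennePrime : ℕ → Set
MersennePrime p = Prime p × Σ ℕ (λ m → (1 ≤ m) × (p ℕ.+ 1 ≡ 2 ℕ.^ m))

{-# OPTIONS --safe #-}
module Submission where

-- A pair (a, b) of non-zero integers is multiplicatively dependent iff |a| = 1, |b| = 1, or |a| and
-- |b| have a common power.  For d = 2h this gives the five pairs (1, d + 1), (−1, d − 1), (−d − 1, −1),
-- (1 − d, 1), (−h, h) and, in four sign patterns each, the pairs 2 ≤ A < B with a common power and
-- A + B = d or B − A = d; so M(2h) = 5 + 2·#{A + B = d} + 2·#{B − A = d}.
-- For d = 2^r q^s with q an odd prime, every prime factor of A divides B and hence d, so A = 2^α q^β and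
-- B = A·C where C = 2^u q^v contains exactly the primes of A.  As 1 + C and C − 1 are prime to C, the
-- pair is (2^r, 2^(r+t)) or (q^s, q^(s+t)), with 2^t ± 1 = q^s or q^t ± 1 = 2^r respectively.  The two
-- Catalan cases (q^s + 1 = 2^t forces s = 1; 2^t + 1 = q^s forces s = 1 or q^s = 9) give the counts.

open import Defs
open import Data.Nat as ℕ
  using (ℕ; zero; suc; _+_; _*_; _^_; _∸_; _≤_; _<_; s≤s; z≤n; NonZero)
import Data.Nat.Properties as ℕₚ
open import Algebra.Properties.CommutativeSemigroup ℕₚ.*-commutativeSemigroup
  using () renaming (interchange to *-interchange; x∙yz≈y∙xz to x*[y*z]≡y*[x*z])
open import Data.Nat.Divisibility
  using (_∣_; divides; ∣1⇒≡1; ∣m+n∣m⇒∣n; ∣m∣n⇒∣m+n; ∣-trans; m∣m*n; n∣m*n; ∣m⇒∣m*n; ∣n⇒∣m*n)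
open import Data.Nat.Coprimality as Coprime using (Coprime; coprime-divisor)
open import Data.Nat.Primality
  using (Prime; prime?; prime[2]; prime⇒nonTrivial; prime⇒irreducible; euclidsLemma)
open import Data.Nat.Primality.Factorisation using (factorise; module PrimeFactorisation)
open import Data.Nat.ListAction using (product)
open import Data.Nat.ListAction.Properties using (∈⇒∣product)
open import Data.Integer as ℤ using (ℤ; +_; -[1+_]; ∣_∣; _⊖_)
import Data.Integer.Properties as ℤₚ
open import Data.Product using (_×_; Σ; _,_; proj₁; proj₂)
open import Data.Sum using (_⊎_; inj₁; inj₂; [_,_]′)
open import Data.Sum.Function.Propositional using (_⊎-⇔_)
open import Data.Empty using (⊥-elim)
open import Data.List using (List; []; _∷_; length; map; _++_)
open import Data.List.Properties using (length-++; length-map)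
open import Data.List.Membership.Propositional using (_∈_)
open import Data.List.Membership.Propositional.Properties
  using (∈-map⁺; ∈-map⁻; ∈-++⁺ˡ; ∈-++⁺ʳ; ∈-++⁻)
open import Data.List.Relation.Unary.Any using (here; there)
open import Data.List.Relation.Unary.All as All using (All; []; _∷_)
open import Data.List.Relation.Unary.AllPairs using ([]; _∷_)
open import Data.List.Relation.Unary.Unique.Propositional using (Unique)
import Data.List.Relation.Unary.Unique.Propositional.Properties as Unique
open import Relation.Binary.PropositionalEquality
  using (_≡_; _≢_; refl; sym; trans; cong; cong₂; subst; subst₂; module ≡-Reasoning)
open import Relation.Binary.Definitions using (tri<; tri≈; tri>)
open import Relation.Nullary using (¬_; contradiction)
open import Relation.Nullary.Decidable using (from-yes)
open import Function using (id; _∘_)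
open import Data.Nat.Tactic.RingSolver using (solve-∀)
open import Function.Bundles using (_⇔_; mk⇔; Equivalence)
open import Function.Definitions using (Injective)
import Function.Properties.Equivalence as ⇔

open Equivalence using (to; from)

-- Finite cardinality

Card : {X : Set} → (X → Set) → ℕ → Set
Card {X} P n = Σ (List X) λ xs → Unique xs × length xs ≡ n × (∀ x → P x ⇔ x ∈ xs)

Image : {X Y : Set} → (X → Y) → (X → Set) → Y → Set
Image {X} f P y = Σ X λ x → P x × f x ≡ y

module _ {X : Set} where

  Card-resp-⇔ : {P Q : X → Set} {n : ℕ} → (∀ x → P x ⇔ Q x) → Card P n → Card Q n
  Card-resp-⇔ P⇔Q (xs , xs! , ∣xs∣ , P⇔∈) = xs , xs! , ∣xs∣ , λ x → ⇔.trans (⇔.sym (P⇔Q x)) (P⇔∈ x)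

  Card-∅ : {P : X → Set} → (∀ x → ¬ P x) → Card P 0
  Card-∅ ¬P = [] , [] , refl , λ x → mk⇔ (λ Px → ⊥-elim (¬P x Px)) λ ()

  Card-unique : {P : X → Set} → (∀ {x y} → P x → P y → x ≡ y) → ∀ {e} → P e → Card P 1
  Card-unique P-unique {e} Pe = e ∷ [] , [] ∷ [] , refl ,
    λ x → mk⇔ (λ Px → here (P-unique Px Pe)) λ { (here refl) → Pe }

  Card-∈ : {xs : List X} → Unique xs → Card (_∈ xs) (length xs)
  Card-∈ {xs} xs! = xs , xs! , refl , λ _ → mk⇔ id id

  Card-⊎ : {P Q : X → Set} {m n : ℕ} → Card P m → Card Q n → (∀ x → P x → ¬ Q x) →
           Card (λ x → P x ⊎ Q x) (m + n)
  Card-⊎ (xs , xs! , refl , P⇔) (ys , ys! , refl , Q⇔) P∩Q≡∅ =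
    xs ++ ys ,
    Unique.++⁺ xs! ys! (λ (x∈xs , x∈ys) → P∩Q≡∅ _ (from (P⇔ _) x∈xs) (from (Q⇔ _) x∈ys)) ,
    length-++ xs ,
    λ x → ⇔.trans (P⇔ x ⊎-⇔ Q⇔ x) (mk⇔ [ ∈-++⁺ˡ , ∈-++⁺ʳ xs ]′ (∈-++⁻ xs))

Card-image : {X Y : Set} {P : X → Set} {n : ℕ} (f : X → Y) → Injective _≡_ _≡_ f →
             Card P n → Card (Image f P) n
Card-image f f-inj (xs , xs! , refl , P⇔) =
  map f xs , Unique.map⁺ f-inj xs! , length-map f xs ,
  λ y → mk⇔ (λ { (x , Px , refl) → ∈-map⁺ f (to (P⇔ x) Px) })
            (λ y∈ → let x , x∈xs , y≡fx = ∈-map⁻ f y∈ in x , from (P⇔ x) x∈xs , sym y≡fx)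

-- Multiplicative dependence through absolute values

CommonPower : ℕ → ℕ → Set
CommonPower A B = Σ ℕ λ x → Σ ℕ λ y → A ^ suc x ≡ B ^ suc y

CommonPower-sym : ∀ {A B} → CommonPower A B → CommonPower B A
CommonPower-sym (x , y , e) = y , x , sym e

MultDepℕ : ℕ → ℕ → Set
MultDepℕ A B = A ≡ 1 ⊎ B ≡ 1 ⊎ CommonPower A B

∣i^n∣≡∣i∣^n : ∀ i n → ∣ i ℤ.^ n ∣ ≡ ∣ i ∣ ^ n
∣i^n∣≡∣i∣^n i zero    = refl
∣i^n∣≡∣i∣^n i (suc n) = trans (ℤₚ.abs-* i (i ℤ.^ n)) (cong (∣ i ∣ *_) (∣i^n∣≡∣i∣^n i n))

i*i≡+∣i∣*∣i∣ : ∀ i → i ℤ.* i ≡ + (∣ i ∣ * ∣ i ∣)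
i*i≡+∣i∣*∣i∣ (+ n)     = sym (ℤₚ.pos-* n n)
i*i≡+∣i∣*∣i∣ -[1+ n ]  = refl

i^[n+n]≡+∣i∣^n*∣i∣^n : ∀ i n → i ℤ.^ (n + n) ≡ + (∣ i ∣ ^ n * ∣ i ∣ ^ n)
i^[n+n]≡+∣i∣^n*∣i∣^n i n = trans (ℤₚ.^-distribˡ-+-* i n n)
  (trans (i*i≡+∣i∣*∣i∣ (i ℤ.^ n)) (cong (λ m → + (m * m)) (∣i^n∣≡∣i∣^n i n)))

private
  A^[1+x]*C≡1⇒A≡1 : ∀ A x C → A ^ suc x * C ≡ 1 → A ≡ 1
  A^[1+x]*C≡1⇒A≡1 A x C eq = ℕₚ.m*n≡1⇒m≡1 A (A ^ x) (ℕₚ.m*n≡1⇒m≡1 (A ^ suc x) C eq)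

  1*B^[1+y]≡1⇒B≡1 : ∀ B y → 1 * B ^ suc y ≡ 1 → B ≡ 1
  1*B^[1+y]≡1⇒B≡1 B y eq = A^[1+x]*C≡1⇒A≡1 B y 1 (trans (ℕₚ.*-comm (B ^ suc y) 1) eq)

PowProdIsOneℕ⇒MultDepℕ : ∀ A B k₁ k₂ → ¬ (k₁ ≡ + 0 × k₂ ≡ + 0) →
  A ^ posPart k₁ * B ^ posPart k₂ ≡ A ^ negPart k₁ * B ^ negPart k₂ → MultDepℕ A B
PowProdIsOneℕ⇒MultDepℕ A B (+ zero)    (+ zero)    k≢0 eq = ⊥-elim (k≢0 (refl , refl))
PowProdIsOneℕ⇒MultDepℕ A B (+ suc x)   (+ y)       k≢0 eq = inj₁ (A^[1+x]*C≡1⇒A≡1 A x _ eq)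
PowProdIsOneℕ⇒MultDepℕ A B (+ zero)    (+ suc y)   k≢0 eq = inj₂ (inj₁ (1*B^[1+y]≡1⇒B≡1 B y eq))
PowProdIsOneℕ⇒MultDepℕ A B (+ zero)    -[1+ y ]    k≢0 eq = inj₂ (inj₁ (1*B^[1+y]≡1⇒B≡1 B y (sym eq)))
PowProdIsOneℕ⇒MultDepℕ A B (+ suc x)   -[1+ y ]    k≢0 eq =
  inj₂ (inj₂ (x , y , trans (sym (ℕₚ.*-identityʳ _)) (trans eq (ℕₚ.*-identityˡ _))))
PowProdIsOneℕ⇒MultDepℕ A B -[1+ x ]    (+ zero)    k≢0 eq = inj₁ (A^[1+x]*C≡1⇒A≡1 A x 1 (sym eq))
PowProdIsOneℕ⇒MultDepℕ A B -[1+ x ]    (+ suc y)   k≢0 eq =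
  inj₂ (inj₂ (x , y , trans (sym (ℕₚ.*-identityʳ _)) (trans (sym eq) (ℕₚ.*-identityˡ _))))
PowProdIsOneℕ⇒MultDepℕ A B -[1+ x ]    -[1+ y ]    k≢0 eq = inj₁ (A^[1+x]*C≡1⇒A≡1 A x _ (sym eq))

MultDep⇒MultDepℕ : ∀ a b → MultDep (a , b) → MultDepℕ ∣ a ∣ ∣ b ∣
MultDep⇒MultDepℕ a b (_ , k₁ , k₂ , k≢0 , eq) = PowProdIsOneℕ⇒MultDepℕ ∣ a ∣ ∣ b ∣ k₁ k₂ k≢0
  (trans (sym (∣a^m*b^n∣ (posPart k₁) (posPart k₂))) (trans (cong ∣_∣ eq) (∣a^m*b^n∣ (negPart k₁) (negPart k₂))))
  where
  ∣a^m*b^n∣ : ∀ m n → ∣ a ℤ.^ m ℤ.* b ℤ.^ n ∣ ≡ ∣ a ∣ ^ m * ∣ b ∣ ^ n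
  ∣a^m*b^n∣ m n = trans (ℤₚ.abs-* (a ℤ.^ m) (b ℤ.^ n)) (cong₂ _*_ (∣i^n∣≡∣i∣^n a m) (∣i^n∣≡∣i∣^n b n))

MultDepℕ⇒MultDep : ∀ a b → a ≢ + 0 → b ≢ + 0 → MultDepℕ ∣ a ∣ ∣ b ∣ → MultDep (a , b)
MultDepℕ⇒MultDep a b a≢0 b≢0 dep = ab≢0 , witness a b dep
  where
  ab≢0 : ¬ (a ℤ.* b ≡ + 0)
  ab≢0 ab≡0 = [ a≢0 , b≢0 ]′ (ℤₚ.i*j≡0⇒i≡0∨j≡0 a ab≡0)

  witness : ∀ a b → MultDepℕ ∣ a ∣ ∣ b ∣ →
            Σ ℤ λ k₁ → Σ ℤ λ k₂ → ¬ (k₁ ≡ + 0 × k₂ ≡ + 0) × PowProdIsOne a b k₁ k₂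
  witness (+ 1)       b (inj₁ refl) = + 2 , + 0 , (λ ()) , refl
  witness -[1+ 0 ]    b (inj₁ refl) = + 2 , + 0 , (λ ()) , refl
  witness a (+ 1)       (inj₂ (inj₁ refl)) = + 0 , + 2 , (λ ()) , refl
  witness a -[1+ 0 ]    (inj₂ (inj₁ refl)) = + 0 , + 2 , (λ ()) , refl
  witness a b (inj₂ (inj₂ (x , y , e))) = + (suc x + suc x) , -[1+ y + suc y ] , (λ ()) , (begin
    a ℤ.^ (suc x + suc x) ℤ.* + 1              ≡⟨ ℤₚ.*-identityʳ _ ⟩
    a ℤ.^ (suc x + suc x)                      ≡⟨ i^[n+n]≡+∣i∣^n*∣i∣^n a (suc x) ⟩
    + (∣ a ∣ ^ suc x * ∣ a ∣ ^ suc x)          ≡⟨ cong (λ m → + (m * m)) e ⟩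
    + (∣ b ∣ ^ suc y * ∣ b ∣ ^ suc y)          ≡⟨ i^[n+n]≡+∣i∣^n*∣i∣^n b (suc y) ⟨
    b ℤ.^ (suc y + suc y)                      ≡⟨ ℤₚ.*-identityˡ _ ⟨
    + 1 ℤ.* b ℤ.^ (suc y + suc y)              ∎)
    where open ≡-Reasoning

MultDep⇒CommonPower : ∀ {a b} → 2 ≤ ∣ a ∣ → 2 ≤ ∣ b ∣ → MultDep (a , b) → CommonPower ∣ a ∣ ∣ b ∣
MultDep⇒CommonPower {a} {b} 2≤∣a∣ 2≤∣b∣ dep with MultDep⇒MultDepℕ a b dep
... | inj₁ ∣a∣≡1         = ⊥-elim (ℕₚ.<⇒≢ 2≤∣a∣ (sym ∣a∣≡1))
... | inj₂ (inj₁ ∣b∣≡1)  = ⊥-elim (ℕₚ.<⇒≢ 2≤∣b∣ (sym ∣b∣≡1))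
... | inj₂ (inj₂ p)      = p

-- M(d) for even d

m⊖n≡+k⇒m≡n+k : ∀ m n k → m ⊖ n ≡ + k → m ≡ n + k
m⊖n≡+k⇒m≡n+k m       zero    k eq = ℤₚ.+-injective eq
m⊖n≡+k⇒m≡n+k zero    (suc n) k ()
m⊖n≡+k⇒m≡n+k (suc m) (suc n) k eq =
  cong suc (m⊖n≡+k⇒m≡n+k m n k (trans (sym (ℤₚ.[1+m]⊖[1+n]≡m⊖n m n)) eq))

[m+n]⊖m≡+n : ∀ m n → (m + n) ⊖ m ≡ + n
[m+n]⊖m≡+n zero    n = refl
[m+n]⊖m≡+n (suc m) n = trans (ℤₚ.[1+m]⊖[1+n]≡m⊖n (m + n) m) ([m+n]⊖m≡+n m n)

m+m≡n+n⇒m≡n : ∀ {m n} → m + m ≡ n + n → m ≡ n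
m+m≡n+n⇒m≡n {m} {n} eq with ℕₚ.<-cmp m n
... | tri< m<n _ _ = ⊥-elim (ℕₚ.<⇒≢ (ℕₚ.+-mono-< m<n m<n) eq)
... | tri≈ _ m≡n _ = m≡n
... | tri> _ _ n<m = ⊥-elim (ℕₚ.<⇒≢ (ℕₚ.+-mono-< n<m n<m) (sym eq))

SumPair : ℕ → ℕ × ℕ → Set
SumPair d (A , B) = 2 ≤ A × A < B × A + B ≡ d × CommonPower A B

DiffPair : ℕ → ℕ × ℕ → Set
DiffPair d (A , B) = 2 ≤ A × A < B × A + d ≡ B × CommonPower A B

sumPairˡ sumPairʳ diffPair⁺ diffPair⁻ : ℕ × ℕ → ℤ × ℤ
sumPairˡ  (A , B) = ℤ.- + A , + B
sumPairʳ  (A , B) = ℤ.- + B , + A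
diffPair⁺ (A , B) = + A , + B
diffPair⁻ (A , B) = ℤ.- + B , ℤ.- + A

private
  -+-injective : ∀ {m n} → ℤ.- + m ≡ ℤ.- + n → m ≡ n
  -+-injective eq = ℤₚ.+-injective (ℤₚ.neg-injective eq)

sumPairˡ-injective : Injective _≡_ _≡_ sumPairˡ
sumPairˡ-injective eq = cong₂ _,_ (-+-injective (cong proj₁ eq)) (ℤₚ.+-injective (cong proj₂ eq))

sumPairʳ-injective : Injective _≡_ _≡_ sumPairʳ
sumPairʳ-injective eq = cong₂ _,_ (ℤₚ.+-injective (cong proj₂ eq)) (-+-injective (cong proj₁ eq))

diffPair⁺-injective : Injective _≡_ _≡_ diffPair⁺
diffPair⁺-injective eq = cong₂ _,_ (ℤₚ.+-injective (cong proj₁ eq)) (ℤₚ.+-injective (cong proj₂ eq))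

diffPair⁻-injective : Injective _≡_ _≡_ diffPair⁻
diffPair⁻-injective eq = cong₂ _,_ (-+-injective (cong proj₂ eq)) (-+-injective (cong proj₁ eq))

Nondegenerate : ℤ × ℤ → Set
Nondegenerate (a , b) = 2 ≤ ∣ a ∣ × 2 ≤ ∣ b ∣ × ∣ a ∣ ≢ ∣ b ∣

private
  2≤2+ : ∀ {n} → 2 ≤ 2 + n
  2≤2+ = s≤s (s≤s z≤n)

  ordered : ∀ {A B} → 2 ≤ A → A < B → 2 ≤ A × 2 ≤ B × A ≢ B
  ordered 2≤A A<B = 2≤A , ℕₚ.≤-trans 2≤A (ℕₚ.<⇒≤ A<B) , ℕₚ.<⇒≢ A<B

  swapped : ∀ {A B} → 2 ≤ A → A < B → 2 ≤ B × 2 ≤ A × B ≢ A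
  swapped 2≤A A<B = let 2≤A , 2≤B , A≢B = ordered 2≤A A<B in 2≤B , 2≤A , A≢B ∘ sym

-- h = c + 2, so that the five trivial pairs are told apart by their constructors.
module EvenDifference (c : ℕ) where

  h d : ℕ
  h = suc (suc c)
  d = h + h

  2+[h+c]≡d : suc (suc (h + c)) ≡ d
  2+[h+c]≡d = cong (suc ∘ suc) (sym (trans (ℕₚ.+-suc c (suc c)) (cong suc (ℕₚ.+-suc c c))))

  -- (1, d + 1), (-1, d - 1), (-d - 1, -1), (1 - d, 1), (-h, h)
  trivialPairs : List (ℤ × ℤ)
  trivialPairs = (+ 1 , + suc d) ∷ (-[1+ 0 ] , + suc (h + c)) ∷ (-[1+ d ] , -[1+ 0 ])
               ∷ (-[1+ h + c ] , + 1) ∷ (-[1+ suc c ] , + h) ∷ []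

  trivialPairs-unique : Unique trivialPairs
  trivialPairs-unique = ((λ ()) ∷ (λ ()) ∷ (λ ()) ∷ (λ ()) ∷ [])
                      ∷ ((λ ()) ∷ (λ ()) ∷ (λ ()) ∷ [])
                      ∷ ((λ ()) ∷ (λ ()) ∷ [])
                      ∷ ((λ ()) ∷ [])
                      ∷ [] ∷ []

  trivialPairs-sound : All (InM (+ d)) trivialPairs
  trivialPairs-sound =
      (MultDepℕ⇒MultDep _ _ (λ ()) (λ ()) (inj₁ refl) , refl)
    ∷ (MultDepℕ⇒MultDep _ _ (λ ()) (λ ()) (inj₁ refl) , cong +_ (trans (ℕₚ.+-comm _ 1) 2+[h+c]≡d))
    ∷ (MultDepℕ⇒MultDep _ _ (λ ()) (λ ()) (inj₂ (inj₁ refl)) , refl)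
    ∷ (MultDepℕ⇒MultDep _ _ (λ ()) (λ ()) (inj₂ (inj₁ refl)) , cong +_ 2+[h+c]≡d)
    ∷ (MultDepℕ⇒MultDep _ _ (λ ()) (λ ()) (inj₂ (inj₂ (0 , 0 , refl))) , refl)
    ∷ []

  trivialPairs-degenerate : All (λ x → ¬ Nondegenerate x) trivialPairs
  trivialPairs-degenerate = (λ { (s≤s () , _) }) ∷ (λ { (s≤s () , _) }) ∷ (λ { (_ , s≤s () , _) })
                          ∷ (λ { (_ , s≤s () , _) }) ∷ (λ { (_ , _ , h≢h) → h≢h refl }) ∷ []

  SumImage DiffImage Ext : ℤ × ℤ → Set
  SumImage  x = Image sumPairˡ (SumPair d) x ⊎ Image sumPairʳ (SumPair d) x
  DiffImage x = Image diffPair⁺ (DiffPair d) x ⊎ Image diffPair⁻ (DiffPair d) x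
  Ext       x = SumImage x ⊎ DiffImage x

  Ext-sound : ∀ x → Ext x → InM (+ d) x
  Ext-sound _ (inj₁ (inj₁ ((suc (suc A) , B) , (s≤s (s≤s _) , s≤s _ , A+B≡d , p) , refl))) =
    MultDepℕ⇒MultDep _ _ (λ ()) (λ ()) (inj₂ (inj₂ p)) , cong +_ (trans (ℕₚ.+-comm B _) A+B≡d)
  Ext-sound _ (inj₁ (inj₂ ((suc (suc A) , B) , (s≤s (s≤s _) , s≤s _ , A+B≡d , p) , refl))) =
    MultDepℕ⇒MultDep _ _ (λ ()) (λ ()) (inj₂ (inj₂ (CommonPower-sym p))) , cong +_ A+B≡d
  Ext-sound _ (inj₂ (inj₁ ((suc (suc A) , B) , (s≤s (s≤s _) , s≤s _ , refl , p) , refl))) =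
    MultDepℕ⇒MultDep _ _ (λ ()) (λ ()) (inj₂ (inj₂ p)) , [m+n]⊖m≡+n (suc (suc A)) d
  Ext-sound _ (inj₂ (inj₂ ((suc (suc A) , B) , (s≤s (s≤s _) , s≤s _ , refl , p) , refl))) =
    MultDepℕ⇒MultDep _ _ (λ ()) (λ ()) (inj₂ (inj₂ (CommonPower-sym p))) , [m+n]⊖m≡+n (suc (suc A)) d

  Ext-nondegenerate : ∀ x → Ext x → Nondegenerate x
  Ext-nondegenerate _ (inj₁ (inj₁ (_ , (2≤A@(s≤s (s≤s _)) , A<B , _) , refl))) = ordered 2≤A A<B
  Ext-nondegenerate _ (inj₁ (inj₂ (_ , (2≤A , A<B@(s≤s _) , _) , refl))) = swapped 2≤A A<B
  Ext-nondegenerate _ (inj₂ (inj₁ (_ , (2≤A , A<B , _) , refl))) = ordered 2≤A A<B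
  Ext-nondegenerate _ (inj₂ (inj₂ (_ , (2≤A@(s≤s (s≤s _)) , A<B@(s≤s _) , _) , refl))) = swapped 2≤A A<B

  Sumˡ∩Sumʳ≡∅ : ∀ x → Image sumPairˡ (SumPair d) x → ¬ Image sumPairʳ (SumPair d) x
  Sumˡ∩Sumʳ≡∅ _ (_ , (_ , A<B , _) , refl) (_ , (_ , A'<B' , _) , eq) =
    ℕₚ.<-asym A<B (subst₂ _<_ (ℤₚ.+-injective (cong proj₂ eq)) (-+-injective (cong proj₁ eq)) A'<B')

  Diff⁺∩Diff⁻≡∅ : ∀ x → Image diffPair⁺ (DiffPair d) x → ¬ Image diffPair⁻ (DiffPair d) x
  Diff⁺∩Diff⁻≡∅ _ (_ , _ , refl) (_ , (_ , s≤s _ , _) , ())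

  Sum∩Diff≡∅ : ∀ x → SumImage x → ¬ DiffImage x
  Sum∩Diff≡∅ _ (inj₁ (_ , (s≤s (s≤s _) , _) , refl)) (inj₁ (_ , _ , ()))
  Sum∩Diff≡∅ _ (inj₁ (_ , _ , refl)) (inj₂ (_ , (s≤s (s≤s _) , _) , ()))
  Sum∩Diff≡∅ _ (inj₂ (_ , (_ , s≤s _ , _) , refl)) (inj₁ (_ , _ , ()))
  Sum∩Diff≡∅ _ (inj₂ (_ , _ , refl)) (inj₂ (_ , (s≤s (s≤s _) , _) , ()))

  DiffPair-from : ∀ A B → 2 ≤ A → B ⊖ A ≡ + d → (2 ≤ B → CommonPower A B) → DiffPair d (A , B)
  DiffPair-from A B 2≤A B⊖A≡d common = 2≤A , A<B , sym B≡A+d , common (ℕₚ.≤-trans 2≤A (ℕₚ.<⇒≤ A<B))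
    where
    B≡A+d : B ≡ A + d
    B≡A+d = m⊖n≡+k⇒m≡n+k B A d B⊖A≡d
    A<B : A < B
    A<B = subst (A <_) (sym B≡A+d) (ℕₚ.m<m+n A (s≤s z≤n))

  complete : ∀ x → InM (+ d) x → x ∈ trivialPairs ⊎ Ext x
  complete (+ zero      , b)                ((ab≢0 , _) , _) = ⊥-elim (ab≢0 refl)
  complete (a           , + zero)           ((ab≢0 , _) , _) = ⊥-elim (ab≢0 (ℤₚ.*-zeroʳ a))
  complete (+ suc _     , -[1+ _ ])         (_ , ())
  complete (+ 1         , + suc B)          (_ , eq) =
    inj₁ (here (cong (λ n → + 1 , + suc n) (ℤₚ.+-injective eq)))
  complete (+ suc (suc A) , + suc B)        (dep , eq) = inj₂ (inj₂ (inj₁ (_ ,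
    DiffPair-from (suc (suc A)) (suc B) 2≤2+ eq (λ 2≤B → MultDep⇒CommonPower 2≤2+ 2≤B dep) , refl)))
  complete (-[1+ 0 ]    , + suc B)          (_ , eq) = inj₁ (there (here (cong (λ n → -[1+ 0 ] , + suc n)
    (ℕₚ.suc-injective (ℕₚ.suc-injective (trans (ℕₚ.+-comm 1 (suc B)) (trans (ℤₚ.+-injective eq) (sym 2+[h+c]≡d))))))))
  complete (-[1+ suc A ] , + 1)             (_ , eq) = inj₁ (there (there (there (here (cong (λ n → -[1+ n ] , + 1)
    (ℕₚ.suc-injective (ℕₚ.suc-injective (trans (ℤₚ.+-injective eq) (sym 2+[h+c]≡d)))))))))
  complete (-[1+ suc A ] , + suc (suc B))   (dep , eq) with ℕₚ.<-cmp A B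
  ... | tri≈ _ refl _ = inj₁ (there (there (there (there (here (cong (λ n → -[1+ suc n ] , + suc (suc n))
    (ℕₚ.suc-injective (ℕₚ.suc-injective (m+m≡n+n⇒m≡n (ℤₚ.+-injective eq))))))))))
  ... | tri< A<B _ _ = inj₂ (inj₁ (inj₁ ((suc (suc A) , suc (suc B)) ,
    (2≤2+ , s≤s (s≤s A<B) , trans (ℕₚ.+-comm (suc (suc A)) _) (ℤₚ.+-injective eq) ,
     MultDep⇒CommonPower 2≤2+ 2≤2+ dep) , refl)))
  ... | tri> _ _ B<A = inj₂ (inj₁ (inj₂ ((suc (suc B) , suc (suc A)) ,
    (2≤2+ , s≤s (s≤s B<A) , ℤₚ.+-injective eq ,
     CommonPower-sym (MultDep⇒CommonPower 2≤2+ 2≤2+ dep)) , refl)))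
  complete (-[1+ A ]    , -[1+ 0 ])         (_ , eq) = inj₁ (there (there (here (cong (λ n → -[1+ n ] , -[1+ 0 ])
    (ℤₚ.+-injective eq)))))
  complete (-[1+ A ]    , -[1+ suc B ])     (dep , eq) = inj₂ (inj₂ (inj₂ (_ ,
    DiffPair-from (suc (suc B)) (suc A) 2≤2+ eq (λ 2≤A → CommonPower-sym (MultDep⇒CommonPower 2≤A 2≤2+ dep)) ,
    refl)))

  M-even : ∀ {D m n} → D ≡ d → Card (SumPair D) m → Card (DiffPair D) n → MEq (+ D) (5 + ((m + m) + (n + n)))
  M-even refl sums diffs = Card-resp-⇔ (λ x → mk⇔ [ All.lookup trivialPairs-sound , Ext-sound x ]′ (complete x))
    (Card-⊎ (Card-∈ trivialPairs-unique)
      (Card-⊎ (Card-⊎ (Card-image sumPairˡ  sumPairˡ-injective  sums)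
                      (Card-image sumPairʳ  sumPairʳ-injective  sums)  Sumˡ∩Sumʳ≡∅)
              (Card-⊎ (Card-image diffPair⁺ diffPair⁺-injective diffs)
                      (Card-image diffPair⁻ diffPair⁻-injective diffs) Diff⁺∩Diff⁻≡∅)
              Sum∩Diff≡∅)
      λ x x∈ ext → All.lookup trivialPairs-degenerate x∈ (Ext-nondegenerate x ext))

-- Divisibility and powers

Odd : ℕ → Set
Odd n = ¬ 2 ∣ n

prime⇒2≤ : ∀ {p} → Prime p → 2 ≤ p
prime⇒2≤ {p} pp = ℕ.nonTrivial⇒n>1 p {{prime⇒nonTrivial pp}}

∤⇒coprime : ∀ {p n} → Prime p → ¬ p ∣ n → Coprime p n
∤⇒coprime pp p∤n (i∣p , i∣n) with prime⇒irreducible pp i∣p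
... | inj₁ i≡1  = i≡1
... | inj₂ refl = ⊥-elim (p∤n i∣n)

coprime-divisor-^ : ∀ {m a o} n → Coprime m a → m ∣ a ^ n * o → m ∣ o
coprime-divisor-^ {m} {o = o} zero    _     m∣1*o = subst (m ∣_) (ℕₚ.*-identityˡ o) m∣1*o
coprime-divisor-^ {m} {a} {o} (suc n) m⊥a m∣a^[1+n]*o =
  coprime-divisor-^ n m⊥a (coprime-divisor m⊥a (subst (m ∣_) (ℕₚ.*-assoc a (a ^ n) o) m∣a^[1+n]*o))

prime∣^⇒∣ : ∀ {p a} n → Prime p → p ∣ a ^ n → p ∣ a
prime∣^⇒∣ zero    pp p∣1 = ⊥-elim (ℕₚ.<⇒≢ (prime⇒2≤ pp) (sym (∣1⇒≡1 p∣1)))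
prime∣^⇒∣ {a = a} (suc n) pp p∣a^[1+n] =
  [ id , prime∣^⇒∣ n pp ]′ (euclidsLemma a (a ^ n) pp p∣a^[1+n])

odd∣2^n⇒≡1 : ∀ {m} n → Odd m → m ∣ 2 ^ n → m ≡ 1
odd∣2^n⇒≡1 {m} n odd m∣2^n = ∣1⇒≡1 (coprime-divisor-^ n (Coprime.sym (∤⇒coprime prime[2] odd))
  (subst (m ∣_) (sym (ℕₚ.*-identityʳ (2 ^ n))) m∣2^n))

∣n⇒∤1+n : ∀ {p n} → 2 ≤ p → p ∣ n → ¬ p ∣ suc n
∣n⇒∤1+n {p} {n} 2≤p p∣n p∣1+n = ℕₚ.<⇒≢ 2≤p (sym (∣1⇒≡1 (∣m+n∣m⇒∣n (subst (p ∣_) (ℕₚ.+-comm 1 n) p∣1+n) p∣n)))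

odd[1+2k] : ∀ k → Odd (suc (2 * k))
odd[1+2k] k (divides j 1+2k≡j*2) = ℕₚ.even≢odd j k (trans (ℕₚ.*-comm 2 j) (sym 1+2k≡j*2))

parity : ∀ n → Σ ℕ λ k → n ≡ 2 * k ⊎ n ≡ suc (2 * k)
parity zero    = 0 , inj₁ refl
parity (suc n) with parity n
... | k , inj₁ n≡2k   = k , inj₂ (cong suc n≡2k)
... | k , inj₂ n≡1+2k = suc k , inj₁ (trans (cong suc n≡1+2k) (sym (ℕₚ.*-suc 2 k)))

odd⇒≡1+2k : ∀ {n} → Odd n → Σ ℕ λ k → n ≡ suc (2 * k)
odd⇒≡1+2k {n} odd with parity n
... | k , inj₁ refl     = ⊥-elim (odd (divides k (ℕₚ.*-comm 2 k)))
... | k , inj₂ n≡1+2k = k , n≡1+2k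

prime∣prime⇒≡ : ∀ {ℓ p} → Prime ℓ → Prime p → ℓ ∣ p → ℓ ≡ p
prime∣prime⇒≡ ℓ-prime p-prime ℓ∣p with prime⇒irreducible p-prime ℓ∣p
... | inj₁ refl = ⊥-elim (ℕₚ.<-irrefl refl (prime⇒2≤ ℓ-prime))
... | inj₂ ℓ≡p  = ℓ≡p

prime[3] : Prime 3
prime[3] = from-yes (prime? 3)

odd-^ : ∀ {q} n → Odd q → Odd (q ^ n)
odd-^ n odd 2∣q^n = odd (prime∣^⇒∣ n prime[2] 2∣q^n)

odd-prime : ∀ {q} → Prime q → 3 ≤ q → Odd q
odd-prime q-prime 3≤q 2∣q = ℕₚ.<-irrefl refl (subst (3 ≤_) (sym (prime∣prime⇒≡ prime[2] q-prime 2∣q)) 3≤q)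

prime≥3∤2^n : ∀ {q} n → Prime q → 3 ≤ q → ¬ q ∣ 2 ^ n
prime≥3∤2^n n q-prime 3≤q q∣2^n =
  ℕₚ.<-irrefl refl (subst (3 ≤_) (prime∣prime⇒≡ q-prime prime[2] (prime∣^⇒∣ n q-prime q∣2^n)) 3≤q)

^-injectiveʳ : ∀ {b} → 2 ≤ b → ∀ {m n} → b ^ m ≡ b ^ n → m ≡ n
^-injectiveʳ {b} 2≤b {m} {n} eq with ℕₚ.<-cmp m n
... | tri< m<n _ _ = ⊥-elim (ℕₚ.<⇒≢ (ℕₚ.^-monoʳ-< b 2≤b m<n) eq)
... | tri≈ _ m≡n _ = m≡n
... | tri> _ _ n<m = ⊥-elim (ℕₚ.<⇒≢ (ℕₚ.^-monoʳ-< b 2≤b n<m) (sym eq))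

m≤m^n : ∀ m {n} → 1 ≤ m → 1 ≤ n → m ≤ m ^ n
m≤m^n m {suc n} (s≤s z≤n) _ = ℕₚ.m≤m*n m (m ^ n) {{ℕ.>-nonZero (ℕₚ.m^n>0 m {{ℕ.>-nonZero (s≤s z≤n)}} n)}}

p∣p^u : ∀ {p u} → 1 ≤ u → p ∣ p ^ u
p∣p^u {p} {suc u} _ = m∣m*n (p ^ u)

A+D≡A*C⇒C≡1+K : ∀ A C .{{_ : NonZero C}} {D} → A + D ≡ A * C → Σ ℕ λ K → C ≡ suc K × A * K ≡ D
A+D≡A*C⇒C≡1+K A (suc K) A+D≡A*C = K , refl , sym (ℕₚ.+-cancelˡ-≡ A _ _ (trans A+D≡A*C (ℕₚ.*-suc A K)))

2≤b^k : ∀ {b k} → 2 ≤ b → 1 ≤ k → 2 ≤ b ^ k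
2≤b^k {b} 2≤b 1≤k = ℕₚ.≤-trans 2≤b (m≤m^n b (ℕₚ.≤-trans (s≤s z≤n) 2≤b) 1≤k)

b^k<b^k*b^t : ∀ {b k t} → 2 ≤ b → 1 ≤ t → b ^ k < b ^ k * b ^ t
b^k<b^k*b^t {b@(suc _)} {k} {t} 2≤b 1≤t = ℕₚ.m<m*n (b ^ k) (b ^ t) {{ℕₚ.m^n≢0 b k}} (2≤b^k 2≤b 1≤t)

-- Two cases of Catalan's equation

private
  odd[3+2e] : ∀ e → Odd (3 + 2 * e)
  odd[3+2e] e = subst Odd (cong suc (ℕₚ.*-suc 2 e)) (odd[1+2k] (suc e))

  ^-double : ∀ q k → q ^ (2 * k) ≡ q ^ k * q ^ k
  ^-double q k = trans (cong (λ n → q ^ (k + n)) (ℕₚ.+-identityʳ k)) (ℕₚ.^-distribˡ-+-* q k k)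

  exponent≥1 : ∀ {s} → 1 ≤ s → s ≡ 1 ⊎ 2 ≤ s
  exponent≥1 (s≤s {n = zero} z≤n)  = inj₁ refl
  exponent≥1 (s≤s {n = suc _} z≤n) = inj₂ (s≤s (s≤s z≤n))

  odd≥3 : ∀ {q} → Odd q → 3 ≤ q → Σ ℕ λ c → q ≡ 3 + 2 * c
  odd≥3 odd 3≤q with odd⇒≡1+2k odd
  odd≥3 odd (s≤s ()) | zero , refl
  ... | suc c , refl = c , cong suc (ℕₚ.*-suc 2 c)

  exponent≥2 : ∀ {s} → 2 ≤ s → (Σ ℕ λ k → 1 ≤ k × s ≡ 2 * k) ⊎ (Σ ℕ λ k → s ≡ 3 + 2 * k)
  exponent≥2 {s} 2≤s with parity s
  exponent≥2 () | zero , inj₁ refl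
  ... | suc k , inj₁ s≡2k = inj₁ (suc k , s≤s z≤n , s≡2k)
  exponent≥2 (s≤s ()) | zero , inj₂ refl
  ... | suc k , inj₂ s≡1+2k = inj₂ (k , trans s≡1+2k (cong suc (ℕₚ.*-suc 2 k)))

  q^k≢1 : ∀ {q k} → 3 ≤ q → 1 ≤ k → q ^ k ≢ 1
  q^k≢1 {q} {k} 3≤q 1≤k q^k≡1 with ℕₚ.m^n≡1⇒n≡0∨m≡1 q k q^k≡1
  ... | inj₁ refl = ℕₚ.<-irrefl refl 1≤k
  ... | inj₂ refl = ℕₚ.<-irrefl refl (ℕₚ.≤-trans (s≤s (s≤s z≤n)) 3≤q)

-- With q = 3 + 2c, the odd cofactor of q^(3+2k) + 1 is q² − q + 1 for k = 0 and passes from A to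
-- q² A − (q − 1); that of q^(3+2k) − 1 is q² + q + 1 and passes from A to q² A + (q + 1).
private
  odd-power+1-base : ∀ c → (3 + 2 * c) * ((3 + 2 * c) * ((3 + 2 * c) * 1)) + 1
                           ≡ (4 + 2 * c) * (3 + 2 * (2 * c * c + 5 * c + 2))
  odd-power+1-base = solve-∀

  odd-power+1-step : ∀ c e → (3 + 2 * c) * (3 + 2 * c) * ((4 + 2 * c) * (3 + 2 * e)) + 1
    ≡ (4 + 2 * c) * (3 + 2 * (4 * c * c * e + 12 * c * e + 9 * e + 6 * c * c + 17 * c + 11))
      + (3 + 2 * c) * (3 + 2 * c)
  odd-power+1-step = solve-∀

  odd-power∸1-base : ∀ c → (3 + 2 * c) * ((3 + 2 * c) * ((3 + 2 * c) * 1))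
                           ≡ 1 + (2 + 2 * c) * (3 + 2 * (2 * c * c + 7 * c + 5))
  odd-power∸1-base = solve-∀

  odd-power∸1-step : ∀ c e → (3 + 2 * c) * ((3 + 2 * c) * (1 + (2 + 2 * c) * (3 + 2 * e)))
    ≡ 1 + (2 + 2 * c) * (3 + 2 * (4 * c * c * e + 12 * c * e + 9 * e + 6 * c * c + 19 * c + 14))
  odd-power∸1-step = solve-∀

  odd²+1 : ∀ e → (1 + 2 * e) * (1 + 2 * e) + 1 ≡ 2 * (1 + 2 * (e * e + e))
  odd²+1 = solve-∀

  odd² : ∀ e → (1 + 2 * e) * (1 + 2 * e) ≡ 4 * (e * (1 + e)) + 1
  odd² = solve-∀

  square-shift : ∀ q x → q * (q * x) + 1 + q * q ≡ q * q * (x + 1) + 1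
  square-shift = solve-∀

odd-power+1≡[q+1]*odd : ∀ c k → Σ ℕ λ e → (3 + 2 * c) ^ (3 + 2 * k) + 1 ≡ (4 + 2 * c) * (3 + 2 * e)
odd-power+1≡[q+1]*odd c zero    = 2 * c * c + 5 * c + 2 , odd-power+1-base c
odd-power+1≡[q+1]*odd c (suc k) with odd-power+1≡[q+1]*odd c k
... | e , ih = 4 * c * c * e + 12 * c * e + 9 * e + 6 * c * c + 17 * c + 11 , ℕₚ.+-cancelʳ-≡ (q * q) _ _ (begin
  q ^ (3 + 2 * suc k) + 1 + q * q         ≡⟨ cong (λ n → q ^ (3 + n) + 1 + q * q) (ℕₚ.*-suc 2 k) ⟩
  q * (q * q ^ (3 + 2 * k)) + 1 + q * q   ≡⟨ square-shift q (q ^ (3 + 2 * k)) ⟩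
  q * q * (q ^ (3 + 2 * k) + 1) + 1       ≡⟨ cong (λ n → q * q * n + 1) ih ⟩
  q * q * ((4 + 2 * c) * (3 + 2 * e)) + 1 ≡⟨ odd-power+1-step c e ⟩
  _                                       ∎)
  where
  open ≡-Reasoning
  q : ℕ
  q = 3 + 2 * c

odd-power≡1+[q∸1]*odd : ∀ c k → Σ ℕ λ e → (3 + 2 * c) ^ (3 + 2 * k) ≡ 1 + (2 + 2 * c) * (3 + 2 * e)
odd-power≡1+[q∸1]*odd c zero    = 2 * c * c + 7 * c + 5 , odd-power∸1-base c
odd-power≡1+[q∸1]*odd c (suc k) with odd-power≡1+[q∸1]*odd c k
... | e , ih = 4 * c * c * e + 12 * c * e + 9 * e + 6 * c * c + 19 * c + 14 , (begin
  q ^ (3 + 2 * suc k)                           ≡⟨ cong (λ n → q ^ (3 + n)) (ℕₚ.*-suc 2 k) ⟩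
  q * (q * q ^ (3 + 2 * k))                     ≡⟨ cong (λ n → q * (q * n)) ih ⟩
  q * (q * (1 + (2 + 2 * c) * (3 + 2 * e)))     ≡⟨ odd-power∸1-step c e ⟩
  _                                             ∎)
  where
  open ≡-Reasoning
  q : ℕ
  q = 3 + 2 * c

odd^s+1≢2^t : ∀ {q s} t → Odd q → 3 ≤ q → 2 ≤ s → q ^ s + 1 ≢ 2 ^ t
odd^s+1≢2^t {q} {s} t odd 3≤q 2≤s q^s+1≡2^t with exponent≥2 2≤s
... | inj₁ (k , 1≤k , refl) with odd⇒≡1+2k (odd-^ k odd)
...   | e , q^k≡1+2e = q^k≢1 3≤q 1≤k (trans q^k≡1+2e (cong (λ n → suc (2 * n)) e≡0))
  where
  2^t≡2*odd : 2 ^ t ≡ 2 * (1 + 2 * (e * e + e))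
  2^t≡2*odd = begin
    2 ^ t                                   ≡⟨ q^s+1≡2^t ⟨
    q ^ (2 * k) + 1                         ≡⟨ cong (_+ 1) (trans (^-double q k) (cong₂ _*_ q^k≡1+2e q^k≡1+2e)) ⟩
    (1 + 2 * e) * (1 + 2 * e) + 1           ≡⟨ odd²+1 e ⟩
    2 * (1 + 2 * (e * e + e))               ∎
    where open ≡-Reasoning
  e≡0 : e ≡ 0
  e≡0 = ℕₚ.m+n≡0⇒n≡0 (e * e) (ℕₚ.m+n≡0⇒m≡0 (e * e + e)
          (ℕₚ.suc-injective (odd∣2^n⇒≡1 t (odd[1+2k] (e * e + e)) (divides 2 2^t≡2*odd))))
odd^s+1≢2^t {q} {s} t odd 3≤q 2≤s q^s+1≡2^t | inj₂ (k , refl) with odd≥3 odd 3≤q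
... | c , refl with odd-power+1≡[q+1]*odd c k
...   | e , q^s+1≡[q+1]*odd = contradiction (odd∣2^n⇒≡1 t (odd[3+2e] e)
          (divides (4 + 2 * c) (trans (sym q^s+1≡2^t) q^s+1≡[q+1]*odd))) λ ()

2^t+1≡q^s⇒q≡3×s≡2 : ∀ {q s} t → Odd q → 3 ≤ q → 2 ≤ s → 2 ^ t + 1 ≡ q ^ s → q ≡ 3 × s ≡ 2
2^t+1≡q^s⇒q≡3×s≡2 {q} {s} t odd 3≤q 2≤s 2^t+1≡q^s with exponent≥2 2≤s
... | inj₁ (k , 1≤k , refl) with odd⇒≡1+2k (odd-^ k odd)
...   | e , q^k≡1+2e = q≡3 , cong (2 *_) k≡1
  where
  2^t≡4*e[1+e] : 2 ^ t ≡ 4 * (e * (1 + e))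
  2^t≡4*e[1+e] = ℕₚ.+-cancelʳ-≡ 1 _ _ (begin
    2 ^ t + 1                   ≡⟨ 2^t+1≡q^s ⟩
    q ^ (2 * k)                 ≡⟨ trans (^-double q k) (cong₂ _*_ q^k≡1+2e q^k≡1+2e) ⟩
    (1 + 2 * e) * (1 + 2 * e)   ≡⟨ odd² e ⟩
    4 * (e * (1 + e)) + 1       ∎)
    where open ≡-Reasoning
  e∣2^t : e ∣ 2 ^ t
  e∣2^t = ∣-trans (m∣m*n (1 + e)) (divides 4 2^t≡4*e[1+e])
  1+e∣2^t : 1 + e ∣ 2 ^ t
  1+e∣2^t = ∣-trans (n∣m*n e) (divides 4 2^t≡4*e[1+e])
  e≡1 : e ≡ 1
  e≡1 with parity e
  ... | j , inj₁ e≡2j = contradiction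
    (trans q^k≡1+2e (cong (λ n → suc (2 * n)) (trans e≡2j (ℕₚ.suc-injective
      (odd∣2^n⇒≡1 t (odd[1+2k] j) (subst (λ n → suc n ∣ 2 ^ t) e≡2j 1+e∣2^t))))))
    (q^k≢1 3≤q 1≤k)
  ... | j , inj₂ e≡1+2j = odd∣2^n⇒≡1 t (subst Odd (sym e≡1+2j) (odd[1+2k] j)) e∣2^t
  q^k≡3 : q ^ k ≡ 3
  q^k≡3 = trans q^k≡1+2e (cong (λ n → suc (2 * n)) e≡1)
  q≡3 : q ≡ 3
  q≡3 = ℕₚ.≤-antisym (subst (q ≤_) q^k≡3 (m≤m^n q (ℕₚ.≤-trans (s≤s z≤n) 3≤q) 1≤k)) 3≤q
  k≡1 : k ≡ 1
  k≡1 = ^-injectiveʳ (ℕₚ.≤-trans (s≤s (s≤s z≤n)) 3≤q) (trans q^k≡3 (sym (trans (ℕₚ.*-identityʳ q) q≡3)))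
2^t+1≡q^s⇒q≡3×s≡2 {q} {s} t odd 3≤q 2≤s 2^t+1≡q^s | inj₂ (k , refl) with odd≥3 odd 3≤q
... | c , refl with odd-power≡1+[q∸1]*odd c k
...   | e , q^s≡1+[q-1]*odd = contradiction (odd∣2^n⇒≡1 t (odd[3+2e] e)
          (divides (2 + 2 * c) (ℕₚ.+-cancelʳ-≡ 1 _ _ (trans 2^t+1≡q^s (trans q^s≡1+[q-1]*odd (ℕₚ.+-comm 1 _)))))) λ ()

-- Numbers built from the primes 2 and q

p^a*m≡p^b*n⇒a≡b×m≡n : ∀ {p} → 2 ≤ p → ∀ a b {m n} → ¬ p ∣ m → ¬ p ∣ n → p ^ a * m ≡ p ^ b * n → a ≡ b × m ≡ n
p^a*m≡p^b*n⇒a≡b×m≡n _ zero zero {m} {n} _ _ eq = refl , trans (sym (ℕₚ.*-identityˡ m)) (trans eq (ℕₚ.*-identityˡ n))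
p^a*m≡p^b*n⇒a≡b×m≡n {p} _ zero (suc b) {m} {n} p∤m _ eq =
  ⊥-elim (p∤m (subst (p ∣_) (trans (sym eq) (ℕₚ.*-identityˡ m)) (∣m⇒∣m*n n (m∣m*n (p ^ b)))))
p^a*m≡p^b*n⇒a≡b×m≡n {p} _ (suc a) zero {m} {n} _ p∤n eq =
  ⊥-elim (p∤n (subst (p ∣_) (trans eq (ℕₚ.*-identityˡ n)) (∣m⇒∣m*n m (m∣m*n (p ^ a)))))
p^a*m≡p^b*n⇒a≡b×m≡n {p@(suc _)} 2≤p (suc a) (suc b) {m} {n} p∤m p∤n eq
  with p^a*m≡p^b*n⇒a≡b×m≡n 2≤p a b p∤m p∤n
         (ℕₚ.*-cancelˡ-≡ _ _ p (trans (sym (ℕₚ.*-assoc p (p ^ a) m)) (trans eq (ℕₚ.*-assoc p (p ^ b) n))))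
... | refl , m≡n = refl , m≡n

Support⊆2q : ℕ → ℕ → Set
Support⊆2q q n = ∀ {ℓ} → Prime ℓ → ℓ ∣ n → ℓ ≡ 2 ⊎ ℓ ≡ q

private
  product≡2^α*q^β : ∀ q {ps} → All (λ ℓ → ℓ ≡ 2 ⊎ ℓ ≡ q) ps →
                    Σ ℕ λ α → Σ ℕ λ β → product ps ≡ 2 ^ α * q ^ β
  product≡2^α*q^β q [] = 0 , 0 , refl
  product≡2^α*q^β q (inj₁ refl ∷ ps) with product≡2^α*q^β q ps
  ... | α , β , eq = suc α , β , trans (cong (2 *_) eq) (sym (ℕₚ.*-assoc 2 (2 ^ α) (q ^ β)))
  product≡2^α*q^β q (inj₂ refl ∷ ps) with product≡2^α*q^β q ps
  ... | α , β , eq = α , suc β , trans (cong (q *_) eq) (x*[y*z]≡y*[x*z] q (2 ^ α) (q ^ β))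

Support⊆2q⇒≡2^α*q^β : ∀ q {n} → 1 ≤ n → Support⊆2q q n → Σ ℕ λ α → Σ ℕ λ β → n ≡ 2 ^ α * q ^ β
Support⊆2q⇒≡2^α*q^β q {n@(suc _)} _ support =
  let α , β , eq = product≡2^α*q^β q (All.tabulate λ ℓ∈ps →
                     support (All.lookup factorsPrime ℓ∈ps) (subst (_ ∣_) (sym isFactorisation) (∈⇒∣product ℓ∈ps)))
  in α , β , trans isFactorisation eq
  where open PrimeFactorisation (factorise n)

2^r*q^s-support : ∀ {q} r s → Prime q → Support⊆2q q (2 ^ r * q ^ s)
2^r*q^s-support {q} r s q-prime {ℓ} ℓ-prime ℓ∣d with euclidsLemma (2 ^ r) (q ^ s) ℓ-prime ℓ∣d
... | inj₁ ℓ∣2^r = inj₁ (prime∣prime⇒≡ ℓ-prime prime[2] (prime∣^⇒∣ r ℓ-prime ℓ∣2^r))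
... | inj₂ ℓ∣q^s = inj₂ (prime∣prime⇒≡ ℓ-prime q-prime (prime∣^⇒∣ s ℓ-prime ℓ∣q^s))

2^a*q^b-injective : ∀ {q} → Prime q → 3 ≤ q → ∀ {a b c e} → 2 ^ a * q ^ b ≡ 2 ^ c * q ^ e → a ≡ c × b ≡ e
2^a*q^b-injective q-prime 3≤q {a} {b} {c} {e} eq
  with p^a*m≡p^b*n⇒a≡b×m≡n (s≤s (s≤s z≤n)) a c (odd-^ b (odd-prime q-prime 3≤q)) (odd-^ e (odd-prime q-prime 3≤q)) eq
... | a≡c , q^b≡q^e = a≡c , ^-injectiveʳ (ℕₚ.≤-trans (s≤s (s≤s z≤n)) 3≤q) q^b≡q^e

^-distribʳ-* : ∀ a b n → (a * b) ^ n ≡ a ^ n * b ^ n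
^-distribʳ-* a b zero    = refl
^-distribʳ-* a b (suc n) = trans (cong (a * b *_) (^-distribʳ-* a b n)) (*-interchange a b (a ^ n) (b ^ n))

A^[1+x]≡B^[1+y]⇒y<x : ∀ {A B} x y → 1 ≤ A → A < B → A ^ suc x ≡ B ^ suc y → y < x
A^[1+x]≡B^[1+y]⇒y<x {A} {B} x y 1≤A A<B eq with ℕₚ.<-cmp y x
... | tri< y<x _ _ = y<x
... | tri≈ _ refl _ = ⊥-elim (ℕₚ.<⇒≢ (ℕₚ.^-monoˡ-< (suc y) A<B) eq)
... | tri> _ _ x<y = ⊥-elim (ℕₚ.<⇒≢ (ℕₚ.≤-<-trans (ℕₚ.^-monoʳ-≤ A {{ℕ.>-nonZero 1≤A}} (s≤s (ℕₚ.<⇒≤ x<y)))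
                                                  (ℕₚ.^-monoˡ-< (suc y) A<B)) eq)

SameSupport : ℕ → ℕ → Set
SameSupport α u = (α ≡ 0 × u ≡ 0) ⊎ (1 ≤ α × 1 ≤ u)

-- α and γ are the exponents of one prime in A and B, where A^(1+x) = B^(1+y) and y < x.
scaled-exponents : ∀ α γ {x y} → y < x → α * suc x ≡ γ * suc y → Σ ℕ λ u → γ ≡ α + u × SameSupport α u
scaled-exponents zero    γ {y = y} _   eq = 0 , ℕₚ.m*n≡0⇒m≡0 γ (suc y) (sym eq) , inj₁ (refl , refl)
scaled-exponents (suc α) γ {x} {y} y<x eq with ℕₚ.<-cmp (suc α) γ
... | tri< α<γ _ _ = γ ∸ suc α , sym (ℕₚ.m+[n∸m]≡n (ℕₚ.<⇒≤ α<γ)) , inj₂ (s≤s z≤n , ℕₚ.m<n⇒0<n∸m α<γ)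
... | tri≈ _ refl _ =
  ⊥-elim (ℕₚ.<-irrefl refl (subst (suc y <_) (ℕₚ.*-cancelˡ-≡ (suc x) (suc y) (suc α) eq) (s≤s y<x)))
... | tri> _ _ γ<α = ⊥-elim (ℕₚ.<⇒≢ (ℕₚ.≤-<-trans (ℕₚ.*-monoˡ-≤ (suc y) (ℕₚ.<⇒≤ γ<α))
                                                   (ℕₚ.*-monoʳ-< (suc α) (s≤s y<x))) (sym eq))

private
  [2^α*q^β]^n : ∀ q α β n → (2 ^ α * q ^ β) ^ n ≡ 2 ^ (α * n) * q ^ (β * n)
  [2^α*q^β]^n q α β n = trans (^-distribʳ-* (2 ^ α) (q ^ β) n) (cong₂ _*_ (ℕₚ.^-*-assoc 2 α n) (ℕₚ.^-*-assoc q β n))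

  2^[α+u]*q^[β+v] : ∀ q α β u v → 2 ^ (α + u) * q ^ (β + v) ≡ 2 ^ α * q ^ β * (2 ^ u * q ^ v)
  2^[α+u]*q^[β+v] q α β u v = trans (cong₂ _*_ (ℕₚ.^-distribˡ-+-* 2 α u) (ℕₚ.^-distribˡ-+-* q β v))
                                    (*-interchange (2 ^ α) (2 ^ u) (q ^ β) (q ^ v))

CommonPower⇒≡*2^u*q^v : ∀ {q} → Prime q → 3 ≤ q → ∀ {α β γ δ} → let A = 2 ^ α * q ^ β; B = 2 ^ γ * q ^ δ in
  1 ≤ A → A < B → CommonPower A B →
  Σ ℕ λ u → Σ ℕ λ v → B ≡ A * (2 ^ u * q ^ v) × SameSupport α u × SameSupport β v
CommonPower⇒≡*2^u*q^v {q} q-prime 3≤q {α} {β} {γ} {δ} 1≤A A<B (x , y , A^[1+x]≡B^[1+y])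
  with 2^a*q^b-injective q-prime 3≤q (trans (sym ([2^α*q^β]^n q α β (suc x)))
                                     (trans A^[1+x]≡B^[1+y] ([2^α*q^β]^n q γ δ (suc y))))
... | eq₂ , eq_q with A^[1+x]≡B^[1+y]⇒y<x x y 1≤A A<B A^[1+x]≡B^[1+y]
... | y<x with scaled-exponents α γ y<x eq₂ | scaled-exponents β δ y<x eq_q
... | u , refl , α~u | v , refl , β~v = u , v , 2^[α+u]*q^[β+v] q α β u v , α~u , β~v

CommonPower-∣ : ∀ {A B ℓ} → CommonPower A B → Prime ℓ → ℓ ∣ A → ℓ ∣ B
CommonPower-∣ {A} {B} {ℓ} (x , y , A^[1+x]≡B^[1+y]) ℓ-prime ℓ∣A =
  prime∣^⇒∣ (suc y) ℓ-prime (subst (ℓ ∣_) A^[1+x]≡B^[1+y] (∣m⇒∣m*n (A ^ x) ℓ∣A))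

powerPair : ℕ → ℕ → ℕ → ℕ × ℕ
powerPair b k t = b ^ k , b ^ k * b ^ t

powerPair-injective : ∀ {b} → 2 ≤ b → ∀ k → Injective _≡_ _≡_ (powerPair b k)
powerPair-injective {b@(suc _)} 2≤b k eq =
  ^-injectiveʳ 2≤b (ℕₚ.*-cancelˡ-≡ _ _ (b ^ k) {{ℕₚ.m^n≢0 b k}} (cong proj₂ eq))

powerPair-CommonPower : ∀ b k t → 1 ≤ k → CommonPower (b ^ k) (b ^ k * b ^ t)
powerPair-CommonPower b (suc k) t _ = k + t , k , (begin
  (b ^ suc k) ^ suc (k + t)        ≡⟨ ℕₚ.^-*-assoc b (suc k) (suc (k + t)) ⟩
  b ^ (suc k * suc (k + t))        ≡⟨ cong (b ^_) (ℕₚ.*-comm (suc k) (suc (k + t))) ⟩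
  b ^ (suc (k + t) * suc k)        ≡⟨ ℕₚ.^-*-assoc b (suc (k + t)) (suc k) ⟨
  (b ^ (suc k + t)) ^ suc k        ≡⟨ cong (_^ suc k) (ℕₚ.^-distribˡ-+-* b (suc k) t) ⟩
  (b ^ suc k * b ^ t) ^ suc k      ∎)
  where open ≡-Reasoning

2^r*m≡h+h : ∀ {r m} → 1 ≤ r → 2 ≤ m → Σ ℕ λ c → 2 ^ r * m ≡ EvenDifference.d c
2^r*m≡h+h {suc r} {m} _ 2≤m
  with 2 ^ r * m | ℕₚ.≤-trans 2≤m (ℕₚ.m≤n*m m (2 ^ r) {{ℕₚ.m^n≢0 2 r}}) | ℕₚ.*-assoc 2 (2 ^ r) m
... | zero        | ()         | _
... | suc zero    | s≤s ()     | _
... | suc (suc c) | _          | eq = c , trans eq (cong (λ n → suc (suc c) + n) (ℕₚ.+-identityʳ (suc (suc c))))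

module PowerPairs {q} (q-prime : Prime q) (3≤q : 3 ≤ q) {r s} (1≤r : 1 ≤ r) (1≤s : 1 ≤ s) where

  d : ℕ
  d = 2 ^ r * q ^ s

  SumExp₂ SumExpq DiffExp₂ DiffExpq : ℕ → Set
  SumExp₂  t = 1 ≤ t × 2 ^ t + 1 ≡ q ^ s
  SumExpq  t = 1 ≤ t × q ^ t + 1 ≡ 2 ^ r
  DiffExp₂ t = 1 ≤ t × q ^ s + 1 ≡ 2 ^ t
  DiffExpq t = 1 ≤ t × 2 ^ r + 1 ≡ q ^ t

  private
    2≤q : 2 ≤ q
    2≤q = ℕₚ.≤-trans (s≤s (s≤s z≤n)) 3≤q

    2^u*q^v≢0 : ∀ u v → NonZero (2 ^ u * q ^ v)
    2^u*q^v≢0 u v = ℕₚ.m*n≢0 (2 ^ u) (q ^ v) {{ℕₚ.m^n≢0 2 u}}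
                              {{ℕₚ.m^n≢0 q v {{ℕ.>-nonZero (ℕₚ.≤-trans (s≤s z≤n) 2≤q)}}}}

    odd-q^s : Odd (q ^ s)
    odd-q^s = odd-^ s (odd-prime q-prime 3≤q)

  common-divisors⇒≡*2^u*q^v : ∀ {A B} → 2 ≤ A → A < B → CommonPower A B →
    (∀ {ℓ} → Prime ℓ → ℓ ∣ A → ℓ ∣ B → ℓ ∣ d) →
    Σ ℕ λ α → Σ ℕ λ β → Σ ℕ λ u → Σ ℕ λ v →
      A ≡ 2 ^ α * q ^ β × B ≡ A * (2 ^ u * q ^ v) × SameSupport α u × SameSupport β v
  common-divisors⇒≡*2^u*q^v {A} {B} 2≤A A<B p ∣d
    with Support⊆2q⇒≡2^α*q^β q (ℕₚ.≤-trans (s≤s z≤n) 2≤A)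
           (λ ℓ-prime ℓ∣A → 2^r*q^s-support r s q-prime ℓ-prime (∣d ℓ-prime ℓ∣A (CommonPower-∣ p ℓ-prime ℓ∣A)))
       | Support⊆2q⇒≡2^α*q^β q (ℕₚ.≤-trans (s≤s z≤n) (ℕₚ.≤-trans 2≤A (ℕₚ.<⇒≤ A<B)))
           (λ ℓ-prime ℓ∣B → 2^r*q^s-support r s q-prime ℓ-prime
                               (∣d ℓ-prime (CommonPower-∣ {B} (CommonPower-sym {A} {B} p) ℓ-prime ℓ∣B) ℓ∣B))
  ... | α , β , refl | γ , δ , refl
    with CommonPower⇒≡*2^u*q^v q-prime 3≤q {α} {β} {γ} {δ} (ℕₚ.≤-trans (s≤s z≤n) 2≤A) A<B p
  ... | u , v , B≡A*C , α~u , β~v = α , β , u , v , refl , B≡A*C , α~u , β~v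

  cofactor : ∀ {α β u v K} → 2 ≤ 2 ^ α * q ^ β → SameSupport α u → SameSupport β v →
             (1 ≤ u → ¬ 2 ∣ K) → (1 ≤ v → ¬ q ∣ K) → 2 ^ α * q ^ β * K ≡ d →
             (1 ≤ u × β ≡ 0 × v ≡ 0 × α ≡ r × K ≡ q ^ s) ⊎
             (1 ≤ v × α ≡ 0 × u ≡ 0 × β ≡ s × K ≡ 2 ^ r) ⊎ (1 ≤ u × 1 ≤ v × K ≡ 1)
  cofactor (s≤s ()) (inj₁ (refl , refl)) (inj₁ (refl , refl)) _ _ _
  cofactor {α} {K = K} _ (inj₂ (_ , 1≤u)) (inj₁ (refl , refl)) 2∤K _ eq
    with p^a*m≡p^b*n⇒a≡b×m≡n (s≤s (s≤s z≤n)) α r (2∤K 1≤u) odd-q^s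
           (trans (cong (_* K) (sym (ℕₚ.*-identityʳ (2 ^ α)))) eq)
  ... | α≡r , K≡q^s = inj₁ (1≤u , refl , refl , α≡r , K≡q^s)
  cofactor {β = β} {K = K} _ (inj₁ (refl , refl)) (inj₂ (_ , 1≤v)) _ q∤K eq
    with p^a*m≡p^b*n⇒a≡b×m≡n 2≤q β s (q∤K 1≤v) (prime≥3∤2^n r q-prime 3≤q)
           (trans (cong (_* K) (sym (ℕₚ.*-identityˡ (q ^ β)))) (trans eq (ℕₚ.*-comm (2 ^ r) (q ^ s))))
  ... | β≡s , K≡2^r = inj₂ (inj₁ (1≤v , refl , refl , β≡s , K≡2^r))
  cofactor {α} {β} {K = K} _ (inj₂ (_ , 1≤u)) (inj₂ (_ , 1≤v)) 2∤K q∤K eq =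
    inj₂ (inj₂ (1≤u , 1≤v , ∣1⇒≡1 (coprime-divisor-^ s (Coprime.sym (∤⇒coprime q-prime (q∤K 1≤v)))
      (coprime-divisor-^ r (Coprime.sym (∤⇒coprime prime[2] (2∤K 1≤u)))
        (divides (2 ^ α * q ^ β) (trans (cong (2 ^ r *_) (ℕₚ.*-identityʳ (q ^ s))) (sym eq)))))))

  PowerSumPair PowerDiffPair : ℕ × ℕ → Set
  PowerSumPair  x = Image (powerPair 2 r) SumExp₂  x ⊎ Image (powerPair q s) SumExpq  x
  PowerDiffPair x = Image (powerPair 2 r) DiffExp₂ x ⊎ Image (powerPair q s) DiffExpq x

  private
    2∣2^u*q^v : ∀ {u} v → 1 ≤ u → 2 ∣ 2 ^ u * q ^ v
    2∣2^u*q^v v 1≤u = ∣m⇒∣m*n (q ^ v) (p∣p^u 1≤u)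

    q∣2^u*q^v : ∀ u {v} → 1 ≤ v → q ∣ 2 ^ u * q ^ v
    q∣2^u*q^v u 1≤v = ∣n⇒∣m*n (2 ^ u) (p∣p^u 1≤v)

    2^r-pair : ∀ u → powerPair 2 r u ≡ (2 ^ r * q ^ 0 , 2 ^ r * q ^ 0 * (2 ^ u * q ^ 0))
    2^r-pair u = sym (cong₂ _,_ (ℕₚ.*-identityʳ (2 ^ r))
                                (cong₂ _*_ (ℕₚ.*-identityʳ (2 ^ r)) (ℕₚ.*-identityʳ (2 ^ u))))

    q^s-pair : ∀ v → powerPair q s v ≡ (2 ^ 0 * q ^ s , 2 ^ 0 * q ^ s * (2 ^ 0 * q ^ v))
    q^s-pair v = sym (cong₂ _,_ (ℕₚ.*-identityˡ (q ^ s))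
                                (cong₂ _*_ (ℕₚ.*-identityˡ (q ^ s)) (ℕₚ.*-identityˡ (q ^ v))))

  SumPair⇒PowerSumPair : ∀ x → SumPair d x → PowerSumPair x
  SumPair⇒PowerSumPair (A , B) (2≤A , A<B , A+B≡d , p)
    with common-divisors⇒≡*2^u*q^v 2≤A A<B p (λ {ℓ} _ ℓ∣A ℓ∣B → subst (ℓ ∣_) A+B≡d (∣m∣n⇒∣m+n ℓ∣A ℓ∣B))
  ... | α , β , u , v , refl , refl , α~u , β~v
    with cofactor 2≤A α~u β~v (λ 1≤u → ∣n⇒∤1+n (s≤s (s≤s z≤n)) (2∣2^u*q^v v 1≤u))
                              (λ 1≤v → ∣n⇒∤1+n 2≤q (q∣2^u*q^v u 1≤v))
                              (trans (ℕₚ.*-suc (2 ^ α * q ^ β) (2 ^ u * q ^ v)) A+B≡d)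
  ... | inj₁ (1≤u , refl , refl , refl , 1+C≡q^s) =
    inj₁ (u , (1≤u , trans (ℕₚ.+-comm (2 ^ u) 1) (trans (cong suc (sym (ℕₚ.*-identityʳ _))) 1+C≡q^s)) , 2^r-pair u)
  ... | inj₂ (inj₁ (1≤v , refl , refl , refl , 1+C≡2^r)) =
    inj₂ (v , (1≤v , trans (ℕₚ.+-comm (q ^ v) 1) (trans (cong suc (sym (ℕₚ.*-identityˡ _))) 1+C≡2^r)) , q^s-pair v)
  ... | inj₂ (inj₂ (_ , _ , 1+C≡1)) = ⊥-elim (ℕ.≢-nonZero⁻¹ _ {{2^u*q^v≢0 u v}} (ℕₚ.suc-injective 1+C≡1))

  PowerSumPair⇒SumPair : ∀ x → PowerSumPair x → SumPair d x
  PowerSumPair⇒SumPair _ (inj₁ (u , (1≤u , 2^u+1≡q^s) , refl)) =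
    2≤b^k (s≤s (s≤s z≤n)) 1≤r , b^k<b^k*b^t {k = r} (s≤s (s≤s z≤n)) 1≤u ,
    trans (sym (ℕₚ.*-suc (2 ^ r) (2 ^ u))) (cong (2 ^ r *_) (trans (ℕₚ.+-comm 1 (2 ^ u)) 2^u+1≡q^s)) ,
    powerPair-CommonPower 2 r u 1≤r
  PowerSumPair⇒SumPair _ (inj₂ (v , (1≤v , q^v+1≡2^r) , refl)) =
    2≤b^k 2≤q 1≤s , b^k<b^k*b^t {k = s} 2≤q 1≤v ,
    trans (sym (ℕₚ.*-suc (q ^ s) (q ^ v)))
          (trans (cong (q ^ s *_) (trans (ℕₚ.+-comm 1 (q ^ v)) q^v+1≡2^r)) (ℕₚ.*-comm (q ^ s) (2 ^ r))) ,
    powerPair-CommonPower q s v 1≤s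

  DiffPair⇒PowerDiffPair : ∀ x → DiffPair d x → PowerDiffPair x
  DiffPair⇒PowerDiffPair (A , B) (2≤A , A<B , A+d≡B , p)
    with common-divisors⇒≡*2^u*q^v 2≤A A<B p (λ {ℓ} _ ℓ∣A ℓ∣B → ∣m+n∣m⇒∣n (subst (ℓ ∣_) (sym A+d≡B) ℓ∣B) ℓ∣A)
  ... | α , β , u , v , refl , refl , α~u , β~v
    with A+D≡A*C⇒C≡1+K (2 ^ α * q ^ β) (2 ^ u * q ^ v) {{2^u*q^v≢0 u v}} A+d≡B
  ... | K , C≡1+K , A*K≡d
    with cofactor 2≤A α~u β~v (λ 1≤u 2∣K → ∣n⇒∤1+n (s≤s (s≤s z≤n)) 2∣K (subst (2 ∣_) C≡1+K (2∣2^u*q^v v 1≤u)))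
                              (λ 1≤v q∣K → ∣n⇒∤1+n 2≤q q∣K (subst (q ∣_) C≡1+K (q∣2^u*q^v u 1≤v))) A*K≡d
  ... | inj₁ (1≤u , refl , refl , refl , refl) =
    inj₁ (u , (1≤u , trans (ℕₚ.+-comm (q ^ s) 1) (trans (sym C≡1+K) (ℕₚ.*-identityʳ (2 ^ u)))) , 2^r-pair u)
  ... | inj₂ (inj₁ (1≤v , refl , refl , refl , refl)) =
    inj₂ (v , (1≤v , trans (ℕₚ.+-comm (2 ^ r) 1) (trans (sym C≡1+K) (ℕₚ.*-identityˡ (q ^ v)))) , q^s-pair v)
  ... | inj₂ (inj₂ (_ , 1≤v , refl)) = ⊥-elim (prime≥3∤2^n 1 q-prime 3≤q (subst (q ∣_) C≡1+K (q∣2^u*q^v u 1≤v)))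

  PowerDiffPair⇒DiffPair : ∀ x → PowerDiffPair x → DiffPair d x
  PowerDiffPair⇒DiffPair _ (inj₁ (u , (1≤u , q^s+1≡2^u) , refl)) =
    2≤b^k (s≤s (s≤s z≤n)) 1≤r , b^k<b^k*b^t {k = r} (s≤s (s≤s z≤n)) 1≤u ,
    trans (sym (ℕₚ.*-suc (2 ^ r) (q ^ s))) (cong (2 ^ r *_) (trans (ℕₚ.+-comm 1 (q ^ s)) q^s+1≡2^u)) ,
    powerPair-CommonPower 2 r u 1≤r
  PowerDiffPair⇒DiffPair _ (inj₂ (v , (1≤v , 2^r+1≡q^v) , refl)) =
    2≤b^k 2≤q 1≤s , b^k<b^k*b^t {k = s} 2≤q 1≤v ,
    trans (cong (λ n → q ^ s + n) (ℕₚ.*-comm (2 ^ r) (q ^ s)))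
          (trans (sym (ℕₚ.*-suc (q ^ s) (2 ^ r))) (cong (q ^ s *_) (trans (ℕₚ.+-comm 1 (2 ^ r)) 2^r+1≡q^v))) ,
    powerPair-CommonPower q s v 1≤s

  private
    2^r≢q^s : 2 ^ r ≢ q ^ s
    2^r≢q^s 2^r≡q^s = odd-q^s (subst (2 ∣_) 2^r≡q^s (p∣p^u 1≤r))

    Card-SumPair : ∀ {n₁ n₂} → Card SumExp₂ n₁ → Card SumExpq n₂ → Card (SumPair d) (n₁ + n₂)
    Card-SumPair c₁ c₂ = Card-resp-⇔ (λ x → mk⇔ (PowerSumPair⇒SumPair x) (SumPair⇒PowerSumPair x))
      (Card-⊎ (Card-image (powerPair 2 r) (powerPair-injective (s≤s (s≤s z≤n)) r) c₁)
              (Card-image (powerPair q s) (powerPair-injective 2≤q s) c₂)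
              λ { _ (_ , _ , refl) (_ , _ , eq) → 2^r≢q^s (sym (cong proj₁ eq)) })

    Card-DiffPair : ∀ {n₁ n₂} → Card DiffExp₂ n₁ → Card DiffExpq n₂ → Card (DiffPair d) (n₁ + n₂)
    Card-DiffPair c₁ c₂ = Card-resp-⇔ (λ x → mk⇔ (PowerDiffPair⇒DiffPair x) (DiffPair⇒PowerDiffPair x))
      (Card-⊎ (Card-image (powerPair 2 r) (powerPair-injective (s≤s (s≤s z≤n)) r) c₁)
              (Card-image (powerPair q s) (powerPair-injective 2≤q s) c₂)
              λ { _ (_ , _ , refl) (_ , _ , eq) → 2^r≢q^s (sym (cong proj₁ eq)) })


  TwoPowerPairs QPowerPairs : ℕ → Set
  TwoPowerPairs n = Σ ℕ λ n₁ → Σ ℕ λ n₂ → Card SumExp₂ n₁ × Card DiffExp₂ n₂ × n₁ + n₂ ≡ n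
  QPowerPairs   n = Σ ℕ λ n₁ → Σ ℕ λ n₂ → Card SumExpq n₁ × Card DiffExpq n₂ × n₁ + n₂ ≡ n

  M[2^r*q^s] : ∀ {m n} → TwoPowerPairs m → QPowerPairs n → MEq (+ d) (5 + 2 * m + 2 * n)
  M[2^r*q^s] (n₁ , n₃ , c₁ , c₃ , refl) (n₂ , n₄ , c₂ , c₄ , refl) with 2^r*m≡h+h 1≤r (2≤b^k 2≤q 1≤s)
  ... | c , d≡h+h = subst (MEq (+ d)) (regroup n₁ n₂ n₃ n₄)
    (EvenDifference.M-even c d≡h+h (Card-SumPair c₁ c₂) (Card-DiffPair c₃ c₄))
    where
    regroup : ∀ a b c e → 5 + ((a + b + (a + b)) + (c + e + (c + e))) ≡ 5 + 2 * (a + c) + 2 * (b + e)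
    regroup = solve-∀

  SumExp₂-unique : ∀ {t t′} → SumExp₂ t → SumExp₂ t′ → t ≡ t′
  SumExp₂-unique (_ , e) (_ , e′) = ^-injectiveʳ (s≤s (s≤s z≤n)) (ℕₚ.+-cancelʳ-≡ 1 _ _ (trans e (sym e′)))

  SumExpq-unique : ∀ {t t′} → SumExpq t → SumExpq t′ → t ≡ t′
  SumExpq-unique (_ , e) (_ , e′) = ^-injectiveʳ 2≤q (ℕₚ.+-cancelʳ-≡ 1 _ _ (trans e (sym e′)))

  DiffExp₂-unique : ∀ {t t′} → DiffExp₂ t → DiffExp₂ t′ → t ≡ t′
  DiffExp₂-unique (_ , e) (_ , e′) = ^-injectiveʳ (s≤s (s≤s z≤n)) (trans (sym e) e′)

  DiffExpq-unique : ∀ {t t′} → DiffExpq t → DiffExpq t′ → t ≡ t′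
  DiffExpq-unique (_ , e) (_ , e′) = ^-injectiveʳ 2≤q (trans (sym e) e′)

  SumExp₂⇒ : ∀ {t} → SumExp₂ t → s ≡ 1 ⊎ (q ≡ 3 × s ≡ 2)
  SumExp₂⇒ {t} (_ , 2^t+1≡q^s) with exponent≥1 1≤s
  ... | inj₁ s≡1 = inj₁ s≡1
  ... | inj₂ 2≤s = inj₂ (2^t+1≡q^s⇒q≡3×s≡2 t (odd-prime q-prime 3≤q) 3≤q 2≤s 2^t+1≡q^s)

  DiffExp₂⇒ : ∀ {t} → DiffExp₂ t → s ≡ 1
  DiffExp₂⇒ {t} (_ , q^s+1≡2^t) with exponent≥1 1≤s
  ... | inj₁ s≡1 = s≡1
  ... | inj₂ 2≤s = ⊥-elim (odd^s+1≢2^t t (odd-prime q-prime 3≤q) 3≤q 2≤s q^s+1≡2^t)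

  SumExpq⇒ : ∀ {t} → SumExpq t → t ≡ 1
  SumExpq⇒ (1≤t , q^t+1≡2^r) with exponent≥1 1≤t
  ... | inj₁ t≡1 = t≡1
  ... | inj₂ 2≤t = ⊥-elim (odd^s+1≢2^t r (odd-prime q-prime 3≤q) 3≤q 2≤t q^t+1≡2^r)

  DiffExpq⇒ : ∀ {t} → DiffExpq t → t ≡ 1 ⊎ (q ≡ 3 × t ≡ 2)
  DiffExpq⇒ (1≤t , 2^r+1≡q^t) with exponent≥1 1≤t
  ... | inj₁ t≡1 = inj₁ t≡1
  ... | inj₂ 2≤t = inj₂ (2^t+1≡q^s⇒q≡3×s≡2 r (odd-prime q-prime 3≤q) 3≤q 2≤t 2^r+1≡q^t)

-- Powers of 2 next to powers of 3

2^a+1≡3^b⇒ : ∀ a b → 1 ≤ b → 2 ^ a + 1 ≡ 3 ^ b → (a ≡ 1 × b ≡ 1) ⊎ (a ≡ 3 × b ≡ 2)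
2^a+1≡3^b⇒ a b 1≤b eq with exponent≥1 1≤b
... | inj₁ refl = inj₁ (^-injectiveʳ {2} ℕₚ.≤-refl {a} {1} (ℕₚ.+-cancelʳ-≡ 1 _ _ eq) , refl)
... | inj₂ 2≤b with 2^t+1≡q^s⇒q≡3×s≡2 a (odd-prime prime[3] ℕₚ.≤-refl) ℕₚ.≤-refl 2≤b eq
...   | _ , refl = inj₂ (^-injectiveʳ {2} ℕₚ.≤-refl {a} {3} (ℕₚ.+-cancelʳ-≡ 1 _ _ eq) , refl)

3^a+1≡2^b⇒ : ∀ a b → 1 ≤ a → 3 ^ a + 1 ≡ 2 ^ b → a ≡ 1 × b ≡ 2
3^a+1≡2^b⇒ a b 1≤a eq with exponent≥1 1≤a
... | inj₁ refl = refl , ^-injectiveʳ {2} ℕₚ.≤-refl {b} {2} (sym eq)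
... | inj₂ 2≤a  = ⊥-elim (odd^s+1≢2^t b (odd-prime prime[3] ℕₚ.≤-refl) ℕₚ.≤-refl 2≤a eq)

private
  1≤n≤3⇒ : ∀ {n} → 1 ≤ n → n ≤ 3 → n ≡ 1 ⊎ n ≡ 2 ⊎ n ≡ 3
  1≤n≤3⇒ {1} _ _ = inj₁ refl
  1≤n≤3⇒ {2} _ _ = inj₂ (inj₁ refl)
  1≤n≤3⇒ {3} _ _ = inj₂ (inj₂ refl)
  1≤n≤3⇒ {suc (suc (suc (suc _)))} _ (s≤s (s≤s (s≤s ())))

module PowersOf3 {r s} (1≤r : 1 ≤ r) (1≤s : 1 ≤ s) where

  open PowerPairs prime[3] ℕₚ.≤-refl 1≤r 1≤s public

  TwoPowerPairs-s≡1 : s ≡ 1 → TwoPowerPairs 2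
  TwoPowerPairs-s≡1 refl = 1 , 1 , Card-unique SumExp₂-unique {1} (s≤s z≤n , refl)
                                 , Card-unique DiffExp₂-unique {2} (s≤s z≤n , refl) , refl

  TwoPowerPairs-s≡2 : s ≡ 2 → TwoPowerPairs 1
  TwoPowerPairs-s≡2 refl = 1 , 0 , Card-unique SumExp₂-unique {3} (s≤s z≤n , refl)
                                 , Card-∅ (λ t (_ , e) → contradiction (proj₁ (3^a+1≡2^b⇒ 2 t 1≤s e)) λ ()) , refl

  TwoPowerPairs-3≤s : 3 ≤ s → TwoPowerPairs 0
  TwoPowerPairs-3≤s 3≤s = 0 , 0
    , Card-∅ (λ t (_ , e) → [ (λ (_ , s≡1) → ℕₚ.<⇒≢ 2≤s (sym s≡1)) , (λ (_ , s≡2) → ℕₚ.<⇒≢ 3≤s (sym s≡2)) ]′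
                               (2^a+1≡3^b⇒ t s 1≤s e))
    , Card-∅ (λ t (_ , e) → ℕₚ.<⇒≢ 2≤s (sym (proj₁ (3^a+1≡2^b⇒ s t 1≤s e)))) , refl
    where
    2≤s : 2 ≤ s
    2≤s = ℕₚ.≤-trans (s≤s (s≤s z≤n)) 3≤s

  QPowerPairs-r≡1 : r ≡ 1 → QPowerPairs 1
  QPowerPairs-r≡1 refl = 0 , 1 , Card-∅ (λ t (1≤t , e) → contradiction (proj₂ (3^a+1≡2^b⇒ t 1 1≤t e)) λ ())
                               , Card-unique DiffExpq-unique {1} (s≤s z≤n , refl) , refl

  QPowerPairs-r≡2 : r ≡ 2 → QPowerPairs 1
  QPowerPairs-r≡2 refl = 1 , 0 , Card-unique SumExpq-unique {1} (s≤s z≤n , refl)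
                               , Card-∅ (λ t (1≤t , e) → [ (λ ()) ∘ proj₁ , (λ ()) ∘ proj₁ ]′ (2^a+1≡3^b⇒ 2 t 1≤t e))
                               , refl

  QPowerPairs-r≡3 : r ≡ 3 → QPowerPairs 1
  QPowerPairs-r≡3 refl = 0 , 1 , Card-∅ (λ t (1≤t , e) → contradiction (proj₂ (3^a+1≡2^b⇒ t 3 1≤t e)) λ ())
                               , Card-unique DiffExpq-unique {2} (s≤s z≤n , refl) , refl

  QPowerPairs-4≤r : 4 ≤ r → QPowerPairs 0
  QPowerPairs-4≤r 4≤r = 0 , 0
    , Card-∅ (λ t (1≤t , e) → ℕₚ.<⇒≢ 2<r (sym (proj₂ (3^a+1≡2^b⇒ t r 1≤t e))))
    , Card-∅ (λ t (1≤t , e) → [ (λ (r≡1 , _) → ℕₚ.<⇒≢ (ℕₚ.<-trans (s≤s (s≤s z≤n)) 2<r) (sym r≡1))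
                              , (λ (r≡3 , _) → ℕₚ.<⇒≢ 4≤r (sym r≡3)) ]′ (2^a+1≡3^b⇒ r t 1≤t e))
    , refl
    where
    2<r : 2 < r
    2<r = ℕₚ.≤-trans (s≤s (s≤s (s≤s z≤n))) 4≤r

  QPowerPairs-r≤3 : r ≤ 3 → QPowerPairs 1
  QPowerPairs-r≤3 r≤3 = [ QPowerPairs-r≡1 , [ QPowerPairs-r≡2 , QPowerPairs-r≡3 ]′ ]′ (1≤n≤3⇒ 1≤r r≤3)

M[2^r*3^s] : (r s : ℕ) → 1 ≤ r → 1 ≤ s →
  (r ≤ 3 →
    (s ≡ 1 → MEq (+ (2 ^ r * 3 ^ s)) 11) ×
    (s ≡ 2 → MEq (+ (2 ^ r * 3 ^ s)) 9) ×
    (3 ≤ s → MEq (+ (2 ^ r * 3 ^ s)) 7)) ×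
  (4 ≤ r →
    (s ≡ 1 → MEq (+ (2 ^ r * 3 ^ s)) 9) ×
    (s ≡ 2 → MEq (+ (2 ^ r * 3 ^ s)) 7) ×
    (3 ≤ s → MEq (+ (2 ^ r * 3 ^ s)) 5))
M[2^r*3^s] r s 1≤r 1≤s = (λ r≤3 → by-s (QPowerPairs-r≤3 r≤3)) , (λ 4≤r → by-s (QPowerPairs-4≤r 4≤r))
  where
  open PowersOf3 1≤r 1≤s
  by-s : ∀ {n} → QPowerPairs n →
    (s ≡ 1 → MEq (+ (2 ^ r * 3 ^ s)) (5 + 2 * 2 + 2 * n)) ×
    (s ≡ 2 → MEq (+ (2 ^ r * 3 ^ s)) (5 + 2 * 1 + 2 * n)) ×
    (3 ≤ s → MEq (+ (2 ^ r * 3 ^ s)) (5 + 2 * 0 + 2 * n))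
  by-s q-pairs = (λ s≡1 → M[2^r*q^s] (TwoPowerPairs-s≡1 s≡1) q-pairs)
               , (λ s≡2 → M[2^r*q^s] (TwoPowerPairs-s≡2 s≡2) q-pairs)
               , (λ 3≤s → M[2^r*q^s] (TwoPowerPairs-3≤s 3≤s) q-pairs)

-- Powers of 2 next to powers of a prime p ≥ 5

Fermat-Mersenne : ∀ {p m n} → 1 ≤ m → p ≡ 2 ^ m + 1 → p + 1 ≡ 2 ^ n → p ≡ 3
Fermat-Mersenne {m = 1} _ refl _ = refl
Fermat-Mersenne {m = suc (suc k)} {n} _ refl p+1≡2^n =
  ⊥-elim (ℕ.≢-nonZero⁻¹ (2 ^ suc k) {{ℕₚ.m^n≢0 2 (suc k)}} (ℕₚ.+-cancelʳ-≡ 1 _ 0 X+1≡1))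
  where
  X : ℕ
  X = 2 ^ suc k
  X+1≡1 : X + 1 ≡ 1
  X+1≡1 = odd∣2^n⇒≡1 n
    (λ 2∣X+1 → ∣n⇒∤1+n (s≤s (s≤s z≤n)) (m∣m*n (2 ^ k)) (subst (2 ∣_) (ℕₚ.+-comm X 1) 2∣X+1))
    (divides 2 (trans (sym p+1≡2^n) (double-plus-two X)))
    where
    double-plus-two : ∀ x → 2 * x + 1 + 1 ≡ 2 * (x + 1)
    double-plus-two = solve-∀

module PowersOfPrime≥5 {p} (p-prime : Prime p) (5≤p : 5 ≤ p) {r s} (1≤r : 1 ≤ r) (1≤s : 1 ≤ s) where

  private
    3≤p : 3 ≤ p
    3≤p = ℕₚ.≤-trans (s≤s (s≤s (s≤s z≤n))) 5≤p

    p≢3 : p ≢ 3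
    p≢3 p≡3 = ℕₚ.<⇒≢ (ℕₚ.≤-trans (s≤s (s≤s (s≤s (s≤s z≤n)))) 5≤p) (sym p≡3)

    p^1≡p : p ^ 1 ≡ p
    p^1≡p = ℕₚ.*-identityʳ p

  open PowerPairs p-prime 3≤p 1≤r 1≤s public

  SumExp₂⇒Fermat : ∀ {t} → SumExp₂ t → s ≡ 1 × p ≡ 2 ^ t + 1
  SumExp₂⇒Fermat {t} e@(_ , 2^t+1≡p^s) with SumExp₂⇒ e
  ... | inj₁ refl       = refl , sym (trans 2^t+1≡p^s p^1≡p)
  ... | inj₂ (p≡3 , _)  = ⊥-elim (p≢3 p≡3)

  DiffExp₂⇒Mersenne : ∀ {t} → DiffExp₂ t → s ≡ 1 × p + 1 ≡ 2 ^ t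
  DiffExp₂⇒Mersenne e@(_ , p^s+1≡2^t) with DiffExp₂⇒ e
  ... | refl = refl , trans (cong (_+ 1) (sym p^1≡p)) p^s+1≡2^t

  Fermat⇒¬Mersenne : ∀ {m} n → 1 ≤ m → p ≡ 2 ^ m + 1 → p + 1 ≢ 2 ^ n
  Fermat⇒¬Mersenne n 1≤m p≡2^m+1 p+1≡2^n = p≢3 (Fermat-Mersenne {n = n} 1≤m p≡2^m+1 p+1≡2^n)

  SumExpq⇒Mersenne : ∀ {t} → SumExpq t → p + 1 ≡ 2 ^ r
  SumExpq⇒Mersenne e@(_ , p^t+1≡2^r) with SumExpq⇒ e
  ... | refl = trans (cong (_+ 1) (sym p^1≡p)) p^t+1≡2^r

  DiffExpq⇒Fermat : ∀ {t} → DiffExpq t → p ≡ 2 ^ r + 1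
  DiffExpq⇒Fermat e@(_ , 2^r+1≡p^t) with DiffExpq⇒ e
  ... | inj₁ refl      = sym (trans 2^r+1≡p^t p^1≡p)
  ... | inj₂ (p≡3 , _) = ⊥-elim (p≢3 p≡3)

  TwoPowerPairs-Fermat : ∀ {m} → s ≡ 1 → 1 ≤ m → p ≡ 2 ^ m + 1 → TwoPowerPairs 1
  TwoPowerPairs-Fermat {m} refl 1≤m p≡2^m+1 =
    1 , 0 , Card-unique SumExp₂-unique {m} (1≤m , trans (sym p≡2^m+1) (sym p^1≡p))
          , Card-∅ (λ t e → Fermat⇒¬Mersenne t 1≤m p≡2^m+1 (proj₂ (DiffExp₂⇒Mersenne e))) , refl

  TwoPowerPairs-Mersenne : ∀ {m} → s ≡ 1 → 1 ≤ m → p + 1 ≡ 2 ^ m → TwoPowerPairs 1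
  TwoPowerPairs-Mersenne {m} refl 1≤m p+1≡2^m =
    0 , 1 , Card-∅ (λ t e@(1≤t , _) → Fermat⇒¬Mersenne m 1≤t (proj₂ (SumExp₂⇒Fermat e)) p+1≡2^m)
          , Card-unique DiffExp₂-unique {m} (1≤m , trans (cong (_+ 1) p^1≡p) p+1≡2^m) , refl

  TwoPowerPairs-none : (∀ {t} → 1 ≤ t → s ≡ 1 → ¬ (p ≡ 2 ^ t + 1 ⊎ p + 1 ≡ 2 ^ t)) → TwoPowerPairs 0
  TwoPowerPairs-none none =
    0 , 0 , Card-∅ (λ _ e@(1≤t , _) → let s≡1 , p≡2^t+1 = SumExp₂⇒Fermat e in none 1≤t s≡1 (inj₁ p≡2^t+1))
          , Card-∅ (λ _ e@(1≤t , _) → let s≡1 , p+1≡2^t = DiffExp₂⇒Mersenne e in none 1≤t s≡1 (inj₂ p+1≡2^t))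
          , refl

  QPowerPairs-one : p ≡ 2 ^ r + 1 ⊎ p + 1 ≡ 2 ^ r → QPowerPairs 1
  QPowerPairs-one (inj₁ p≡2^r+1) =
    0 , 1 , Card-∅ (λ _ e → Fermat⇒¬Mersenne r 1≤r p≡2^r+1 (SumExpq⇒Mersenne e))
          , Card-unique DiffExpq-unique {1} (s≤s z≤n , trans (sym p≡2^r+1) (sym p^1≡p)) , refl
  QPowerPairs-one (inj₂ p+1≡2^r) =
    1 , 0 , Card-unique SumExpq-unique {1} (s≤s z≤n , trans (cong (_+ 1) p^1≡p) p+1≡2^r)
          , Card-∅ (λ _ e → Fermat⇒¬Mersenne r 1≤r (DiffExpq⇒Fermat e) p+1≡2^r) , refl

  QPowerPairs-none : ¬ (p ≡ 2 ^ r + 1 ⊎ p + 1 ≡ 2 ^ r) → QPowerPairs 0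
  QPowerPairs-none none = 0 , 0 , Card-∅ (λ _ e → none (inj₂ (SumExpq⇒Mersenne e)))
                                , Card-∅ (λ _ e → none (inj₁ (DiffExpq⇒Fermat e))) , refl

  TwoPowerPairs-Fermat-or-Mersenne : ∀ {m} → s ≡ 1 → 1 ≤ m → p ≡ 2 ^ m + 1 ⊎ p + 1 ≡ 2 ^ m → TwoPowerPairs 1
  TwoPowerPairs-Fermat-or-Mersenne s≡1 1≤m = [ TwoPowerPairs-Fermat s≡1 1≤m , TwoPowerPairs-Mersenne s≡1 1≤m ]′

M[2^r*p^s] : (p r s : ℕ) → Prime p → 5 ≤ p → 1 ≤ r → 1 ≤ s →
  (s ≡ 1 → (p ≡ 2 ^ r + 1 ⊎ p + 1 ≡ 2 ^ r) → MEq (+ (2 ^ r * p ^ s)) 9) ×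
  (2 ≤ s → (p ≡ 2 ^ r + 1 ⊎ p + 1 ≡ 2 ^ r) → MEq (+ (2 ^ r * p ^ s)) 7) ×
  (s ≡ 1 →
    ((FermatPrime p × p ≢ 2 ^ r + 1) ⊎ (MersennePrime p × p + 1 ≢ 2 ^ r)) →
    MEq (+ (2 ^ r * p ^ s)) 7) ×
  (¬ (p ≡ 2 ^ r + 1 ⊎ p + 1 ≡ 2 ^ r) →
    ¬ ((s ≡ 1) × ((FermatPrime p × p ≢ 2 ^ r + 1) ⊎ (MersennePrime p × p + 1 ≢ 2 ^ r))) →
    MEq (+ (2 ^ r * p ^ s)) 5)
M[2^r*p^s] p r s p-prime 5≤p 1≤r 1≤s = near-s≡1 , near-2≤s , special , generic
  where
  open PowersOfPrime≥5 p-prime 5≤p 1≤r 1≤s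

  near-s≡1 : s ≡ 1 → (p ≡ 2 ^ r + 1 ⊎ p + 1 ≡ 2 ^ r) → MEq (+ (2 ^ r * p ^ s)) 9
  near-s≡1 s≡1 near = M[2^r*q^s] (TwoPowerPairs-Fermat-or-Mersenne s≡1 1≤r near) (QPowerPairs-one near)

  near-2≤s : 2 ≤ s → (p ≡ 2 ^ r + 1 ⊎ p + 1 ≡ 2 ^ r) → MEq (+ (2 ^ r * p ^ s)) 7
  near-2≤s 2≤s near = M[2^r*q^s] (TwoPowerPairs-none (λ _ s≡1 _ → ℕₚ.<⇒≢ 2≤s (sym s≡1))) (QPowerPairs-one near)

  special : s ≡ 1 → ((FermatPrime p × p ≢ 2 ^ r + 1) ⊎ (MersennePrime p × p + 1 ≢ 2 ^ r)) →
            MEq (+ (2 ^ r * p ^ s)) 7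
  special s≡1 (inj₁ ((_ , m , 1≤m , p≡2^m+1) , p≢2^r+1)) =
    M[2^r*q^s] (TwoPowerPairs-Fermat s≡1 1≤m p≡2^m+1)
               (QPowerPairs-none [ p≢2^r+1 , Fermat⇒¬Mersenne r 1≤m p≡2^m+1 ]′)
  special s≡1 (inj₂ ((_ , m , 1≤m , p+1≡2^m) , p+1≢2^r)) =
    M[2^r*q^s] (TwoPowerPairs-Mersenne s≡1 1≤m p+1≡2^m)
               (QPowerPairs-none [ (λ p≡2^r+1 → Fermat⇒¬Mersenne m 1≤r p≡2^r+1 p+1≡2^m) , p+1≢2^r ]′)

  generic : ¬ (p ≡ 2 ^ r + 1 ⊎ p + 1 ≡ 2 ^ r) →
            ¬ ((s ≡ 1) × ((FermatPrime p × p ≢ 2 ^ r + 1) ⊎ (MersennePrime p × p + 1 ≢ 2 ^ r))) →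
            MEq (+ (2 ^ r * p ^ s)) 5
  generic not-near not-special = M[2^r*q^s] (TwoPowerPairs-none not-special-form) (QPowerPairs-none not-near)
    where
    not-special-form : ∀ {t} → 1 ≤ t → s ≡ 1 → ¬ (p ≡ 2 ^ t + 1 ⊎ p + 1 ≡ 2 ^ t)
    not-special-form 1≤t s≡1 (inj₁ p≡2^t+1) =
      not-special (s≡1 , inj₁ ((p-prime , _ , 1≤t , p≡2^t+1) , not-near ∘ inj₁))
    not-special-form 1≤t s≡1 (inj₂ p+1≡2^t) =
      not-special (s≡1 , inj₂ ((p-prime , _ , 1≤t , p+1≡2^t) , not-near ∘ inj₂))

theorem4p3 :
    ((r s : ℕ) → 1 ≤ r → 1 ≤ s →
      (r ≤ 3 →
        (s ≡ 1 → MEq (+ (2 ^ r * 3 ^ s)) 11) ×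
        (s ≡ 2 → MEq (+ (2 ^ r * 3 ^ s)) 9) ×
        (3 ≤ s → MEq (+ (2 ^ r * 3 ^ s)) 7)) ×
      (4 ≤ r →
        (s ≡ 1 → MEq (+ (2 ^ r * 3 ^ s)) 9) ×
        (s ≡ 2 → MEq (+ (2 ^ r * 3 ^ s)) 7) ×
        (3 ≤ s → MEq (+ (2 ^ r * 3 ^ s)) 5)))
    ×
    ((p r s : ℕ) → Prime p → 5 ≤ p → 1 ≤ r → 1 ≤ s →
      (s ≡ 1 → (p ≡ 2 ^ r + 1 ⊎ p + 1 ≡ 2 ^ r) → MEq (+ (2 ^ r * p ^ s)) 9) ×
      (2 ≤ s → (p ≡ 2 ^ r + 1 ⊎ p + 1 ≡ 2 ^ r) → MEq (+ (2 ^ r * p ^ s)) 7) ×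
      (s ≡ 1 →
        ((FermatPrime p × p ≢ 2 ^ r + 1) ⊎ (MersennePrime p × p + 1 ≢ 2 ^ r)) →
        MEq (+ (2 ^ r * p ^ s)) 7) ×
      (¬ (p ≡ 2 ^ r + 1 ⊎ p + 1 ≡ 2 ^ r) →
        ¬ ((s ≡ 1) × ((FermatPrime p × p ≢ 2 ^ r + 1) ⊎ (MersennePrime p × p + 1 ≢ 2 ^ r))) →
        MEq (+ (2 ^ r * p ^ s)) 5))
theorem4p3 = M[2^r*3^s] , M[2^r*p^s]
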